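{- Let $A=(a_{i,j})_{1\le i\le m,\,1\le j\le n}$ be an $m\times n$ matrix over a commutative ring with unity, $m\le n$, let $1\le k\le m-1$ and $\bar\beta\in Q_{k,m}$. Then $$\mathrm{per}(z;A)=\sum_{\varphi\in\mathrm{Inj}(\{\bar\beta\},N_n)}z^{|\varphi|}\Big(\prod_{i\in\{\bar\beta\}}a_{i,\varphi(i)}\Big)\,\mathrm{per}\big(z;A[N_m\setminus\{\bar\beta\}\,|\,\bar\varphi(N_n)]\big).$$
   Context: $N_n=\{1,\dots,n\}$; $Q_{k,m}$ is the set of strictly increasing sequences of length $k$ with entries in $N_m$, and $\{\bar\beta\}$ is the set of entries of $\bar\beta$. For $S\subseteq N_n$, $\mathrm{Inj}(S,N_n)$ is the set of injective maps $S\to N_n$; for $\varphi\in\mathrm{Inj}(S,N_n)$, $|\varphi|$ is the number of cycles of $\varphi$, i.e. the number of nonempty sets $C\subseteq S$ of the form $\{j,\varphi(j),\dots,\varphi^{p-1}(j)\}$ with $\varphi^p(j)=j$. For a $p\times q$ matrix $B=(b_{i,j})$, $p\le q$, the cyclic permanent is $\mathrm{per}(z;B)=\sum_{\varphi\in\mathrm{Inj}(N_p,N_q)}z^{|\varphi|}\prod_{i=1}^p b_{i,\varphi(i)}$. For a set $T$ of row indices and a sequence $(c_1,\dots,c_q)$ of column indices, $A[T\,|\,c_1,\dots,c_q]$ is the matrix formed by the rows of $A$ indexed by $T$ in increasing order whose $s$-th column is column $c_s$ of $A$, re-indexed by $1,2,\dots$ in rows and columns. For $S\subseteq N_n$ and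 $\varphi\in\mathrm{Inj}(S,N_n)$ define $\varphi^*:\varphi(S)\setminus S\to S\setminus\varphi(S)$ by: for $j\in\varphi(S)\setminus S$, $j_0=j$, $j_l=\varphi^{ -1}(j_{l-1})$ while $j_{l-1}\in\varphi(S)$, and $\varphi^*(j)$ is the first $j_l$ lying in $S\setminus\varphi(S)$. For a sequence $(x_1,\dots,x_n)$, $\bar\varphi(x_1,\dots,x_n)$ is $(y_j)_{j\in N_n\setminus S}$ in increasing order of $j$, with $y_j=x_j$ if $j\notin\varphi(S)$ and $y_j=x_{\varphi^*(j)}$ if $j\in\varphi(S)\setminus S$; $\bar\varphi(N_n)=\bar\varphi(1,\dots,n)$. -}

module Defs where

open import Level using (Level)
open import Algebra.Bundles using (CommutativeRing)
open import Data.Nat as ℕ using (ℕ; zero; suc; _≤_)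
open import Data.Bool using (Bool; true; false)
open import Data.Fin as Fin using (Fin; toℕ; inject≤)
open import Data.Fin.Properties using (any?; all?)
open import Data.Fin.Subset using (Subset)
open import Data.Maybe using (Maybe; just; nothing; _>>=_)
import Data.Maybe.Properties as MaybeP
open import Data.List as List using (List; []; _∷_; filter; length; concatMap; allFin)
open import Data.Vec as Vec using (Vec; lookup; tabulate)
import Data.Vec.Properties as VecP
import Data.Bool.Properties as BoolP
open import Data.Product using (Σ; ∃; _×_; _,_)
open import Relation.Nullary using (Dec; yes; no; ¬_; does)
open import Relation.Nullary.Decidable using (_×-dec_; _→-dec_; ¬?)
open import Relation.Binary.PropositionalEquality using (_≡_)

allVecs : ∀ {a} {A : Set a} → List A → (k : ℕ) → List (Vec A k)
allVecs xs zero    = Vec.[] ∷ []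
allVecs xs (suc k) = concatMap (λ x → List.map (x Vec.∷_) (allVecs xs k)) xs

allSubsets : (N : ℕ) → List (Subset N)
allSubsets N = allVecs (true ∷ false ∷ []) N

Injective : ∀ {p q} → (Fin p → Fin q) → Set
Injective f = ∀ i j → f i ≡ f j → i ≡ j

injective? : ∀ {p q} (f : Fin p → Fin q) → Dec (Injective f)
injective? f = all? (λ i → all? (λ j → (f i Fin.≟ f j) →-dec (i Fin.≟ j)))

injections : (p q : ℕ) → List (Vec (Fin q) p)
injections p q = filter (λ v → injective? (lookup v)) (allVecs (allFin q) p)

-- the partial map on Fin N with domain {dom l} sending dom l ↦ vals l
-- (dom is injective in all uses; the first matching l is taken)
findVal : ∀ {k a N} {B : Set} → (Fin k → Fin a) → (Fin k → B) → Fin N → Maybe B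
findVal {zero}  dom vals j = nothing
findVal {suc k} dom vals j with toℕ (dom Fin.zero) ℕ.≟ toℕ j
... | yes _ = just (vals Fin.zero)
... | no  _ = findVal (λ l → dom (Fin.suc l)) (λ l → vals (Fin.suc l)) j

-- an injection φ : N_p → N_q viewed as a partial map on N_q with domain N_p
injMap : ∀ {p q} → (Fin p → Fin q) → Fin q → Maybe (Fin q)
injMap φ = findVal (λ i → i) φ

iter : ∀ {N} → (Fin N → Maybe (Fin N)) → ℕ → Fin N → Maybe (Fin N)
iter f zero    j = just j
iter f (suc p) j = iter f p j >>= f

orbit : ∀ {N} → (Fin N → Maybe (Fin N)) → Fin N → ℕ → Subset N
orbit {N} f j p = tabulate (λ i → does (any? {n = p} (λ l → MaybeP.≡-dec Fin._≟_ (iter f (toℕ l) j) (just i))))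

-- C is a cycle of φ: C = {j, φ(j), …, φ^{p-1}(j)} with φ^p(j) = j, p ≥ 1
-- (p ranges over 1..N, which suffices since a cycle has at most N elements)
IsCycle : ∀ {N} → (Fin N → Maybe (Fin N)) → Subset N → Set
IsCycle {N} f C = Σ (Fin N) λ j → Σ (Fin N) λ p →
  (iter f (suc (toℕ p)) j ≡ just j) × (C ≡ orbit f j (suc (toℕ p)))

isCycle? : ∀ {N} (f : Fin N → Maybe (Fin N)) (C : Subset N) → Dec (IsCycle f C)
isCycle? f C = any? (λ j → any? (λ p →
  MaybeP.≡-dec Fin._≟_ (iter f (suc (toℕ p)) j) (just j)
  ×-dec VecP.≡-dec BoolP._≟_ C (orbit f j (suc (toℕ p)))))

cycles : ∀ {N} → (Fin N → Maybe (Fin N)) → ℕ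
cycles {N} f = length (filter (isCycle? f) (allSubsets N))

-- The sets and sequences of the theorem, for S = {β̄} ⊆ N_m ⊆ N_n and
-- φ ∈ Inj(S, N_n) given by g with φ(β l) = g l.

rowsCompl : ∀ {k m} → (Fin k → Fin m) → List (Fin m)
rowsCompl {m = m} β = filter (λ i → ¬? (any? (λ l → β l Fin.≟ i))) (allFin m)

module _ {k m n : ℕ} (m≤n : m ≤ n) (β : Fin k → Fin m) (g : Fin k → Fin n) where

  βn : Fin k → Fin n
  βn l = inject≤ (β l) m≤n

  inS? : (j : Fin n) → Dec (∃ λ l → βn l ≡ j)
  inS? j = any? (λ l → βn l Fin.≟ j)

  inφS? : (j : Fin n) → Dec (∃ λ l → g l ≡ j)
  inφS? j = any? (λ l → g l Fin.≟ j)

  φmap : Fin n → Maybe (Fin n)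
  φmap = findVal βn g

  φinv : Fin n → Maybe (Fin n)
  φinv = findVal g βn

  -- follow j_l = φ⁻¹(j_{l-1}) while j_{l-1} ∈ φ(S); return the first j_l ∉ φ(S)
  -- (fuel n suffices; the fuel-exhausted branch is never reached)
  back : ℕ → Fin n → Fin n
  back zero       x = x
  back (suc fuel) x with φinv x
  ... | nothing = x
  ... | just x′ with inφS? x′
  ...   | yes _ = back fuel x′
  ...   | no  _ = x′

  φstar : Fin n → Fin n
  φstar j = back n j

  yval : Fin n → Fin n
  yval j with inφS? j
  ... | yes _ = φstar j
  ... | no  _ = j

  φbar : List (Fin n)
  φbar = List.map yval (filter (λ j → ¬? (inS? j)) (allFin n))

module _ {c ℓ : Level} (R : CommutativeRing c ℓ) where
  open CommutativeRing R

  sumL : List Carrier → Carrier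
  sumL = List.foldr _+_ 0#

  prodF : ∀ {p} → (Fin p → Carrier) → Carrier
  prodF {zero}  f = 1#
  prodF {suc p} f = f Fin.zero * prodF (λ i → f (Fin.suc i))

  pow : Carrier → ℕ → Carrier
  pow z zero    = 1#
  pow z (suc e) = z * pow z e

  per : ∀ {p q} → Carrier → (Fin p → Fin q → Carrier) → Carrier
  per {p} {q} z B = sumL (List.map
    (λ v → pow z (cycles (injMap (lookup v)))
           * prodF (λ i → B i (lookup v i)))
    (injections p q))

  subMatrix : ∀ {m n} → (Fin m → Fin n → Carrier) → (rows : List (Fin m)) → (cols : List (Fin n))
            → Fin (length rows) → Fin (length cols) → Carrier
  subMatrix A rows cols r s = A (List.lookup rows r) (List.lookup cols s)

  expansion : ∀ {k m n} → m ≤ n → Carrier → (Fin m → Fin n → Carrier) → (Fin k → Fin m) → Carrier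
  expansion {k} {m} {n} m≤n z A β = sumL (List.map
    (λ v → pow z (cycles (φmap m≤n β (lookup v)))
           * prodF (λ l → A (β l) (lookup v l))
           * per z (subMatrix A (rowsCompl β) (φbar m≤n β (lookup v))))
    (injections k n))

-- An injection v : N_m → N_n splits into its restriction φ to S = {β̄} and its values on the
-- free rows N_m ∖ S, which avoid φ(S). The map j ↦ y_j identifies N_n ∖ S (the index set of
-- φ̄(N_n)) with N_n ∖ φ(S), so the free part of v becomes an injection u between positions,
-- and v ↦ (φ, u) is a bijection onto the pairs indexing the right-hand side. The product of
-- entries splits along S and its complement. The cycles of v are those of φ inside S together
-- with those meeting N_n ∖ S; following such a cycle from one visit of N_n ∖ S to the next is
-- exactly a step of u, so these are the cycles of u and |v| = |φ| + |u|.

module Submission where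

open import Defs
open import Level using (Level)
open import Algebra.Bundles using (CommutativeMonoid; CommutativeRing)
open import Data.Unit using (⊤; tt)
open import Data.Empty using (⊥-elim)
open import Data.Bool using (Bool; true; false)
import Data.Bool.Properties as Boolₚ
open import Data.Nat as ℕ using (ℕ; zero; suc; _∸_; _≤_; _<_; z≤n; s≤s; _≤?_)
import Data.Nat.Properties as ℕₚ
open import Data.Nat.Induction using (<-wellFounded)
open import Data.Fin as Fin using (Fin; toℕ; fromℕ<; inject≤)
open import Data.Fin.Properties
  using (any?; all?; toℕ-fromℕ<; toℕ<n; toℕ-injective; toℕ-inject≤; toℕ-cast; toℕ-mono-<; pigeonhole)
  renaming (_≟_ to _≟ᶠ_)
open import Data.Fin.Subset using (Subset)
open import Data.Maybe as Maybe using (Maybe; just; nothing; _>>=_; fromMaybe)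
open import Data.Maybe.Properties using (just-injective; ≡-dec)
open import Data.Vec as Vec using (Vec; lookup; tabulate)
import Data.Vec.Properties as Vecₚ
open import Data.List as List
  using (List; []; _∷_; length; map; foldr; concatMap; filter; allFin; _++_; applyUpTo; upTo)
import Data.List.Properties as Listₚ
open import Data.List.Membership.Propositional using (_∈_; _∉_; lose; find)
open import Data.List.Membership.Propositional.Properties
  using (∈-map⁺; ∈-map⁻; ∈-++⁺ˡ; ∈-++⁺ʳ; ∈-concatMap⁺; ∈-concatMap⁻; ∈-filter⁺; ∈-filter⁻; ∈-allFin;
         ∈-applyUpTo⁻; ∈-lookup)
open import Data.List.Relation.Unary.Any using (here; there)
import Data.List.Relation.Unary.Any as Any
open import Data.List.Relation.Unary.Any.Properties using (lookup-index)
open import Data.List.Relation.Unary.All using ([]; _∷_)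
open import Data.List.Relation.Unary.All.Properties using (All¬⇒¬Any; ¬Any⇒All¬)
open import Data.List.Relation.Unary.AllPairs using ([]; _∷_)
open import Data.List.Relation.Unary.Unique.Propositional using (Unique)
open import Data.List.Relation.Unary.Unique.Propositional.Properties using (++⁺; filter⁺; allFin⁺)
open import Data.Product using (Σ; ∃; _×_; _,_; proj₁; proj₂)
open import Data.Sum using (_⊎_; inj₁; inj₂)
open import Function using (case_of_)
open import Function.Bundles using (mk⇔)
open import Induction.WellFounded using (Acc; acc)
open import Relation.Nullary using (¬_; Dec; yes; no; does)
open import Relation.Nullary.Decidable using (_×-dec_; ¬?; toSum; does-⇔; dec-true)
open import Relation.Unary using (Decidable)
open import Relation.Binary using (tri<; tri≈; tri>)
open import Relation.Binary.PropositionalEquality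
  using (_≡_; _≢_; refl; sym; trans; cong; cong₂; subst; subst₂; module ≡-Reasoning)

private
  variable
    a b : Level
    A : Set a
    B : Set b

module Combinatorics where
  open import Data.Nat using (_+_; _*_)

  remove : ∀ {x : A} (xs : List A) → x ∈ xs → List A
  remove (_ ∷ xs) (here _)  = xs
  remove (y ∷ xs) (there p) = y ∷ remove xs p

  ∈-remove⁻ : ∀ {x y : A} xs (p : x ∈ xs) → y ∈ remove xs p → y ∈ xs
  ∈-remove⁻ (_ ∷ xs) (here _)  q         = there q
  ∈-remove⁻ (_ ∷ xs) (there p) (here e)  = here e
  ∈-remove⁻ (_ ∷ xs) (there p) (there q) = there (∈-remove⁻ xs p q)

  ∈-remove⁺ : ∀ {x y : A} xs (p : x ∈ xs) → y ∈ xs → y ≢ x → y ∈ remove xs p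
  ∈-remove⁺ (_ ∷ xs) (here refl) (here refl) y≢x = ⊥-elim (y≢x refl)
  ∈-remove⁺ (_ ∷ xs) (here refl) (there q)   _   = q
  ∈-remove⁺ (_ ∷ xs) (there p)   (here e)    _   = here e
  ∈-remove⁺ (_ ∷ xs) (there p)   (there q)   y≢x = there (∈-remove⁺ xs p q y≢x)

  remove-unique : ∀ {x : A} xs (p : x ∈ xs) → Unique xs → Unique (remove xs p) × x ∉ remove xs p
  remove-unique (_ ∷ xs) (here refl) (x∉xs ∷ u) = u , All¬⇒¬Any x∉xs
  remove-unique (y ∷ xs) (there p)   (y∉xs ∷ u) with remove-unique xs p u
  ... | u′ , x∉ = ¬Any⇒All¬ _ (λ q → All¬⇒¬Any y∉xs (∈-remove⁻ xs p q)) ∷ u′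
                , λ { (here refl) → All¬⇒¬Any y∉xs p ; (there q) → x∉ q }

  unique-map⁺ : ∀ (f : A → B) {xs} → (∀ {x y} → x ∈ xs → y ∈ xs → f x ≡ f y → x ≡ y) →
                Unique xs → Unique (map f xs)
  unique-map⁺ f {[]}     _   _          = []
  unique-map⁺ f {x ∷ xs} inj (x∉xs ∷ u) =
    ¬Any⇒All¬ _ (λ q → let y , y∈xs , fx≡fy = ∈-map⁻ f q in
                        All¬⇒¬Any x∉xs (subst (_∈ xs) (sym (inj (here refl) (there y∈xs) fx≡fy)) y∈xs))
    ∷ unique-map⁺ f (λ p q → inj (there p) (there q)) u

  unique-concatMap⁺ : ∀ (F : A → List B) {xs} → Unique xs → (∀ {x} → x ∈ xs → Unique (F x)) →
                      (∀ {x x′ y} → x ∈ xs → x′ ∈ xs → y ∈ F x → y ∈ F x′ → x ≡ x′) →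
                      Unique (concatMap F xs)
  unique-concatMap⁺ F {[]}     _          _  _        = []
  unique-concatMap⁺ F {x ∷ xs} (x∉xs ∷ u) uF disjoint =
    ++⁺ (uF (here refl)) (unique-concatMap⁺ F u (λ p → uF (there p)) (λ p p′ → disjoint (there p) (there p′)))
      λ (y∈Fx , y∈rest) → let x′ , x′∈xs , y∈Fx′ = find (∈-concatMap⁻ F {xs = xs} y∈rest) in
        All¬⇒¬Any x∉xs (subst (_∈ xs) (sym (disjoint (here refl) (there x′∈xs) y∈Fx y∈Fx′)) x′∈xs)

  ∈-concatMap-intro : ∀ (F : A → List B) {xs x y} → x ∈ xs → y ∈ F x → y ∈ concatMap F xs
  ∈-concatMap-intro F x∈xs y∈Fx = ∈-concatMap⁺ F (lose x∈xs y∈Fx)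

  ∈-concatMap-elim : ∀ (F : A → List B) xs {y} → y ∈ concatMap F xs → ∃ λ x → x ∈ xs × y ∈ F x
  ∈-concatMap-elim F xs p = find (∈-concatMap⁻ F {xs = xs} p)

  nth : List A → ℕ → Maybe A
  nth []       _       = nothing
  nth (x ∷ xs) zero    = just x
  nth (x ∷ xs) (suc k) = nth xs k

  nth-lookup : ∀ (xs : List A) i → nth xs (toℕ i) ≡ just (List.lookup xs i)
  nth-lookup (x ∷ xs) Fin.zero    = refl
  nth-lookup (x ∷ xs) (Fin.suc i) = nth-lookup xs i

  nth-∈ : ∀ (xs : List A) k {y} → nth xs k ≡ just y → y ∈ xs
  nth-∈ (x ∷ xs) zero    refl = here refl
  nth-∈ (x ∷ xs) (suc k) e    = there (nth-∈ xs k e)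

  nth-++ˡ : ∀ (xs ys : List A) {k} → k < length xs → nth (xs ++ ys) k ≡ nth xs k
  nth-++ˡ (x ∷ xs) ys {zero}  _         = refl
  nth-++ˡ (x ∷ xs) ys {suc k} (s≤s k<n) = nth-++ˡ xs ys k<n

  nth-++ʳ : ∀ (xs ys : List A) k → nth (xs ++ ys) (length xs + k) ≡ nth ys k
  nth-++ʳ []       ys k = refl
  nth-++ʳ (x ∷ xs) ys k = nth-++ʳ xs ys k

  nth-map : ∀ (f : A → B) xs k → nth (map f xs) k ≡ Maybe.map f (nth xs k)
  nth-map f []       k       = refl
  nth-map f (x ∷ xs) zero    = refl
  nth-map f (x ∷ xs) (suc k) = nth-map f xs k

  lookup-injective : ∀ {xs : List A} → Unique xs → ∀ {i j} → List.lookup xs i ≡ List.lookup xs j → i ≡ j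
  lookup-injective {xs = x ∷ xs} u          {Fin.zero}  {Fin.zero}  e = refl
  lookup-injective {xs = x ∷ xs} (x∉ ∷ u)   {Fin.zero}  {Fin.suc j} e = ⊥-elim (All¬⇒¬Any x∉ (subst (_∈ xs) (sym e) (∈-lookup j)))
  lookup-injective {xs = x ∷ xs} (x∉ ∷ u)   {Fin.suc i} {Fin.zero}  e = ⊥-elim (All¬⇒¬Any x∉ (subst (_∈ xs) e (∈-lookup i)))
  lookup-injective {xs = x ∷ xs} (_ ∷ u)    {Fin.suc i} {Fin.suc j} e = cong Fin.suc (lookup-injective u e)

  map-filter : ∀ (f : A → B) {p q} {P : A → Set p} {Q : B → Set q} (P? : Decidable P) (Q? : Decidable Q) →
               (∀ x → does (P? x) ≡ does (Q? (f x))) → ∀ xs → map f (filter P? xs) ≡ filter Q? (map f xs)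
  map-filter f P? Q? same [] = refl
  map-filter f P? Q? same (x ∷ xs) with P? x | Q? (f x) | same x
  ... | yes _ | yes _ | _ = cong (f x ∷_) (map-filter f P? Q? same xs)
  ... | no _  | no _  | _ = map-filter f P? Q? same xs

  map-toℕ-allFin : ∀ n → map toℕ (allFin n) ≡ upTo n
  map-toℕ-allFin n = trans (Listₚ.map-tabulate (λ i → i) toℕ) (tabulate-toℕ n (λ x → x))
    where
    tabulate-toℕ : ∀ n (h : ℕ → ℕ) → List.tabulate {n = n} (λ i → h (toℕ i)) ≡ applyUpTo h n
    tabulate-toℕ zero    h = refl
    tabulate-toℕ (suc n) h = cong (h 0 ∷_) (tabulate-toℕ n (λ x → h (suc x)))

  applyUpTo-+ : ∀ (h : ℕ → A) m n → applyUpTo h (m + n) ≡ applyUpTo h m ++ applyUpTo (λ x → h (m + x)) n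
  applyUpTo-+ h zero    n = refl
  applyUpTo-+ h (suc m) n = cong (h 0 ∷_) (applyUpTo-+ (λ x → h (suc x)) m n)

  module CommutativeMonoidSum {c ℓ} (M : CommutativeMonoid c ℓ) where
    open CommutativeMonoid M
      renaming (Carrier to C; refl to ≈-refl; sym to ≈-sym; trans to ≈-trans)
    open import Relation.Binary.Reasoning.Setoid setoid

    sumMap : (A → C) → List A → C
    sumMap w xs = foldr _∙_ ε (map w xs)

    sumMap-++ : ∀ (w : A → C) xs ys → sumMap w (xs ++ ys) ≈ sumMap w xs ∙ sumMap w ys
    sumMap-++ w []       ys = ≈-sym (identityˡ _)
    sumMap-++ w (x ∷ xs) ys = ≈-trans (∙-congˡ (sumMap-++ w xs ys)) (≈-sym (assoc _ _ _))

    sumMap-map : ∀ (w : B → C) (f : A → B) xs → sumMap w (map f xs) ≡ sumMap (λ x → w (f x)) xs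
    sumMap-map w f xs = cong (foldr _∙_ ε) (sym (Listₚ.map-∘ xs))

    sumMap-cong : ∀ {w w′ : A → C} xs → (∀ {x} → x ∈ xs → w x ≈ w′ x) → sumMap w xs ≈ sumMap w′ xs
    sumMap-cong []       _   = ≈-refl
    sumMap-cong (x ∷ xs) w≈w′ = ∙-cong (w≈w′ (here refl)) (sumMap-cong xs (λ p → w≈w′ (there p)))

    sumMap-remove : ∀ (w : A → C) {x} xs (p : x ∈ xs) → sumMap w xs ≈ w x ∙ sumMap w (remove xs p)
    sumMap-remove w (_ ∷ xs) (here refl) = ≈-refl
    sumMap-remove w {x} (y ∷ xs) (there p) = begin
      w y ∙ sumMap w xs                    ≈⟨ ∙-congˡ (sumMap-remove w xs p) ⟩
      w y ∙ (w x ∙ sumMap w (remove xs p)) ≈⟨ x∙yz≈y∙xz (w y) (w x) _ ⟩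
      w x ∙ (w y ∙ sumMap w (remove xs p)) ∎
      where open import Algebra.Properties.CommutativeSemigroup commutativeSemigroup using (x∙yz≈y∙xz)

    sumMap-sameElements : ∀ (w : A → C) xs ys → Unique xs → Unique ys →
                          (∀ {x} → x ∈ xs → x ∈ ys) → (∀ {y} → y ∈ ys → y ∈ xs) →
                          sumMap w xs ≈ sumMap w ys
    sumMap-sameElements w [] [] _ _ _ _ = ≈-refl
    sumMap-sameElements w [] (y ∷ ys) _ _ _ ys⊆ with () ← ys⊆ (here refl)
    sumMap-sameElements w (x ∷ xs) ys (x∉xs ∷ uxs) uys xs⊆ ys⊆ = begin
      w x ∙ sumMap w xs                 ≈⟨ ∙-congˡ (sumMap-sameElements w xs (remove ys x∈ys) uxs uys′ xs⊆′ ys⊆′) ⟩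
      w x ∙ sumMap w (remove ys x∈ys)   ≈⟨ ≈-sym (sumMap-remove w ys x∈ys) ⟩
      sumMap w ys                       ∎
      where
      x∈ys = xs⊆ (here refl)
      uys′ = remove-unique ys x∈ys uys .proj₁
      x∉ys′ = remove-unique ys x∈ys uys .proj₂
      xs⊆′ : ∀ {z} → z ∈ xs → z ∈ remove ys x∈ys
      xs⊆′ z∈xs = ∈-remove⁺ ys x∈ys (xs⊆ (there z∈xs)) λ { refl → All¬⇒¬Any x∉xs z∈xs }
      ys⊆′ : ∀ {z} → z ∈ remove ys x∈ys → z ∈ xs
      ys⊆′ z∈ys′ with ys⊆ (∈-remove⁻ ys x∈ys z∈ys′)
      ... | here refl = ⊥-elim (x∉ys′ z∈ys′)
      ... | there z∈xs = z∈xs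

    sumMap-bijection : ∀ (w : B → C) (f : A → B) xs ys → Unique xs → Unique ys →
                       (∀ {x} → x ∈ xs → f x ∈ ys) →
                       (∀ {y} → y ∈ ys → ∃ λ x → x ∈ xs × f x ≡ y) →
                       (∀ {x x′} → x ∈ xs → x′ ∈ xs → f x ≡ f x′ → x ≡ x′) →
                       sumMap (λ x → w (f x)) xs ≈ sumMap w ys
    sumMap-bijection w f xs ys uxs uys into onto inj = begin
      sumMap (λ x → w (f x)) xs ≡⟨ sumMap-map w f xs ⟨
      sumMap w (map f xs)       ≈⟨ sumMap-sameElements w (map f xs) ys (unique-map⁺ f inj uxs) uys image⊆ ys⊆ ⟩
      sumMap w ys               ∎
      where
      image⊆ : ∀ {y} → y ∈ map f xs → y ∈ ys
      image⊆ p = let x , x∈xs , y≡fx = ∈-map⁻ f p in subst (_∈ ys) (sym y≡fx) (into x∈xs)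
      ys⊆ : ∀ {y} → y ∈ ys → y ∈ map f xs
      ys⊆ p = let x , x∈xs , fx≡y = onto p in subst (_∈ map f xs) fx≡y (∈-map⁺ f x∈xs)

  vec-ext : ∀ {n} {v w : Vec A n} → (∀ i → lookup v i ≡ lookup w i) → v ≡ w
  vec-ext {v = v} {w} h = trans (sym (Vecₚ.tabulate∘lookup v)) (trans (Vecₚ.tabulate-cong h) (Vecₚ.tabulate∘lookup w))

  subset-ext : ∀ {N} {C D : Subset N} → (∀ i → lookup C i ≡ true → lookup D i ≡ true) →
               (∀ i → lookup D i ≡ true → lookup C i ≡ true) → C ≡ D
  subset-ext C⊆D D⊆C = vec-ext λ i → Boolₚ.⇔→≡ (mk⇔ (C⊆D i) (D⊆C i))

  ∈-allVecs : ∀ (xs : List A) → (∀ x → x ∈ xs) → ∀ {k} (v : Vec A k) → v ∈ allVecs xs k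
  ∈-allVecs xs complete Vec.[]       = here refl
  ∈-allVecs xs complete (x Vec.∷ v) =
    ∈-concatMap-intro _ (complete x) (∈-map⁺ (x Vec.∷_) (∈-allVecs xs complete v))

  allVecs-unique : ∀ (xs : List A) → Unique xs → ∀ k → Unique (allVecs xs k)
  allVecs-unique xs u zero    = [] ∷ []
  allVecs-unique xs u (suc k) = unique-concatMap⁺ _ u
    (λ _ → unique-map⁺ _ (λ _ _ → Vecₚ.∷-injectiveʳ) (allVecs-unique xs u k))
    λ {x} {x′} _ _ p p′ → let v , _ , e = ∈-map⁻ (x Vec.∷_) p ; v′ , _ , e′ = ∈-map⁻ (x′ Vec.∷_) p′ in
                          Vecₚ.∷-injectiveˡ (trans (sym e) e′)

  ∈-allSubsets : ∀ {N} C → C ∈ allSubsets N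
  ∈-allSubsets = ∈-allVecs _ λ { true → here refl ; false → there (here refl) }

  allSubsets-unique : ∀ N → Unique (allSubsets N)
  allSubsets-unique = allVecs-unique _ (((λ ()) ∷ []) ∷ [] ∷ [])

  ∈-injections⁺ : ∀ {p q} (v : Vec (Fin q) p) → Injective (lookup v) → v ∈ injections p q
  ∈-injections⁺ v inj = ∈-filter⁺ (λ v → injective? (lookup v)) (∈-allVecs _ ∈-allFin v) inj

  ∈-injections⁻ : ∀ {p q} {v : Vec (Fin q) p} → v ∈ injections p q → ∀ {i j} → lookup v i ≡ lookup v j → i ≡ j
  ∈-injections⁻ {p} {q} v∈ = ∈-filter⁻ (λ v → injective? (lookup v)) {xs = allVecs (allFin q) p} v∈ .proj₂ _ _

  injections-unique : ∀ p q → Unique (injections p q)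
  injections-unique p q = filter⁺ (λ v → injective? (lookup v)) (allVecs-unique (allFin q) (allFin⁺ q) p)

  module _ {p q} {P : A → Set p} {Q : B → Set q} (P? : Decidable P) (Q? : Decidable Q) where
    open CommutativeMonoidSum ℕₚ.+-0-commutativeMonoid

    private
      sumMap-one : ∀ {c} {X : Set c} (xs : List X) → sumMap (λ _ → 1) xs ≡ length xs
      sumMap-one []       = refl
      sumMap-one (_ ∷ xs) = cong suc (sumMap-one xs)

    length-filter-bijection : ∀ (f : A → B) xs ys → Unique xs → Unique ys →
      (∀ {x} → x ∈ xs → P x → f x ∈ ys × Q (f x)) →
      (∀ {y} → y ∈ ys → Q y → ∃ λ x → x ∈ xs × P x × f x ≡ y) →
      (∀ {x x′} → x ∈ xs → x′ ∈ xs → P x → P x′ → f x ≡ f x′ → x ≡ x′) →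
      length (filter P? xs) ≡ length (filter Q? ys)
    length-filter-bijection f xs ys uxs uys into onto inj = begin
      length (filter P? xs)              ≡⟨ sumMap-one (filter P? xs) ⟨
      sumMap (λ _ → 1) (filter P? xs)    ≡⟨ sumMap-bijection (λ _ → 1) f (filter P? xs) (filter Q? ys)
                                              (filter⁺ P? uxs) (filter⁺ Q? uys) into′ onto′ inj′ ⟩
      sumMap (λ _ → 1) (filter Q? ys)    ≡⟨ sumMap-one (filter Q? ys) ⟩
      length (filter Q? ys)              ∎
      where
      open ≡-Reasoning
      into′ : ∀ {x} → x ∈ filter P? xs → f x ∈ filter Q? ys
      into′ p = let x∈xs , Px = ∈-filter⁻ P? {xs = xs} p ; fx∈ys , Qfx = into x∈xs Px in ∈-filter⁺ Q? fx∈ys Qfx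
      onto′ : ∀ {y} → y ∈ filter Q? ys → ∃ λ x → x ∈ filter P? xs × f x ≡ y
      onto′ p = let y∈ys , Qy = ∈-filter⁻ Q? {xs = ys} p ; x , x∈xs , Px , fx≡y = onto y∈ys Qy in
                x , ∈-filter⁺ P? x∈xs Px , fx≡y
      inj′ : ∀ {x x′} → x ∈ filter P? xs → x′ ∈ filter P? xs → f x ≡ f x′ → x ≡ x′
      inj′ p p′ = let x∈xs , Px = ∈-filter⁻ P? {xs = xs} p ; x′∈xs , Px′ = ∈-filter⁻ P? {xs = xs} p′ in
                  inj x∈xs x′∈xs Px Px′

  length-filter-split : ∀ {p q} {P : A → Set p} {Q : A → Set q} (P? : Decidable P) (Q? : Decidable Q) xs →
    length (filter P? xs) ≡
    length (filter (λ x → P? x ×-dec Q? x) xs) + length (filter (λ x → P? x ×-dec ¬? (Q? x)) xs)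
  length-filter-split P? Q? [] = refl
  length-filter-split P? Q? (x ∷ xs) with P? x | Q? x
  ... | yes _ | yes _ = cong suc (length-filter-split P? Q? xs)
  ... | yes _ | no _  = trans (cong suc (length-filter-split P? Q? xs)) (sym (ℕₚ.+-suc _ _))
  ... | no _  | yes _ = length-filter-split P? Q? xs
  ... | no _  | no _  = length-filter-split P? Q? xs

  findVal-just⁻ : ∀ {k a N} (dom : Fin k → Fin a) (vals : Fin k → B) {j : Fin N} {v} →
                  findVal dom vals j ≡ just v → ∃ λ l → toℕ (dom l) ≡ toℕ j × vals l ≡ v
  findVal-just⁻ {k = suc k} dom vals {j} e with toℕ (dom Fin.zero) ℕ.≟ toℕ j
  findVal-just⁻ dom vals refl | yes p = Fin.zero , p , refl
  ... | no _ with l , p , q ← findVal-just⁻ (λ l → dom (Fin.suc l)) (λ l → vals (Fin.suc l)) e =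
    Fin.suc l , p , q

  findVal-nothing⁻ : ∀ {k a N} (dom : Fin k → Fin a) (vals : Fin k → B) {j : Fin N} →
                     findVal dom vals j ≡ nothing → ∀ l → toℕ (dom l) ≢ toℕ j
  findVal-nothing⁻ {k = suc k} dom vals {j} e l with toℕ (dom Fin.zero) ℕ.≟ toℕ j
  findVal-nothing⁻ dom vals () l | yes _
  findVal-nothing⁻ dom vals e Fin.zero    | no ¬p = ¬p
  findVal-nothing⁻ dom vals e (Fin.suc l) | no _  = findVal-nothing⁻ (λ l → dom (Fin.suc l)) (λ l → vals (Fin.suc l)) e l

  findVal-just⁺ : ∀ {k a N} (dom : Fin k → Fin a) (vals : Fin k → B) {j : Fin N} →
                  (∀ {l l′} → toℕ (dom l) ≡ toℕ (dom l′) → l ≡ l′) →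
                  ∀ l → toℕ (dom l) ≡ toℕ j → findVal dom vals j ≡ just (vals l)
  findVal-just⁺ dom vals {j} dom-injective l p with findVal dom vals j in eq
  ... | nothing = ⊥-elim (findVal-nothing⁻ dom vals eq l p)
  ... | just _ with l′ , p′ , refl ← findVal-just⁻ dom vals eq =
    cong (λ l → just (vals l)) (dom-injective (trans p′ (sym p)))

  module Iterate {N : ℕ} (f : Fin N → Maybe (Fin N)) where

    iter-+ : ∀ a b {j x} → iter f a j ≡ just x → iter f (b + a) j ≡ iter f b x
    iter-+ a zero    e = e
    iter-+ a (suc b) e rewrite iter-+ a b e = refl

    iter-+-nothing : ∀ a b {j} → iter f a j ≡ nothing → iter f (b + a) j ≡ nothing
    iter-+-nothing a zero    e = e
    iter-+-nothing a (suc b) e rewrite iter-+-nothing a b e = refl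

    iter-trans : ∀ a b {x y z} → iter f a x ≡ just y → iter f b y ≡ just z → iter f (b + a) x ≡ just z
    iter-trans a b e₁ e₂ = trans (iter-+ a b e₁) e₂

    iter-suc-first : ∀ p {j x} → f j ≡ just x → iter f (suc p) j ≡ iter f p x
    iter-suc-first p {j} {x} e = subst (λ t → iter f t j ≡ iter f p x) (ℕₚ.+-comm p 1) (iter-+ 1 p e)

    iter-suc-first-nothing : ∀ p {j} → f j ≡ nothing → iter f (suc p) j ≡ nothing
    iter-suc-first-nothing p {j} e = subst (λ t → iter f t j ≡ nothing) (ℕₚ.+-comm p 1) (iter-+-nothing 1 p e)

    iter-suc-last : ∀ a {x y} → iter f (suc a) x ≡ just y → ∃ λ u → iter f a x ≡ just u × f u ≡ just y
    iter-suc-last a {x} e with iter f a x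
    ... | just u = u , refl , e

    iter-prefix : ∀ a b {j i} → iter f (b + a) j ≡ just i → ∃ λ x → iter f a j ≡ just x
    iter-prefix a b {j} e with iter f a j in eq
    ... | just x  = x , refl
    ... | nothing with () ← trans (sym e) (iter-+-nothing a b eq)

    iter-multiple : ∀ a {j} → iter f (suc a) j ≡ just j → ∀ t → iter f (t * suc a) j ≡ just j
    iter-multiple a e zero    = refl
    iter-multiple a e (suc t) = trans (iter-+ (t * suc a) (suc a) (iter-multiple a e t)) e

    iter-periodic-reduce : ∀ p {j} → iter f (suc p) j ≡ just j → ∀ l {i} → iter f l j ≡ just i →
                           ∃ λ l′ → l′ ≤ p × iter f l′ j ≡ just i
    iter-periodic-reduce p {j} per l = go l (<-wellFounded l)
      where
      go : ∀ l → Acc _<_ l → ∀ {i} → iter f l j ≡ just i → ∃ λ l′ → l′ ≤ p × iter f l′ j ≡ just i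
      go l (acc rs) e with l ≤? p
      ... | yes l≤p = l , l≤p , e
      ... | no  l≰p = go (l ∸ suc p) (rs (ℕₚ.∸-monoʳ-< {o = 0} (s≤s z≤n) p<l))
                        (trans (sym (iter-+ (suc p) (l ∸ suc p) per))
                               (subst (λ t → iter f t j ≡ _) (sym (ℕₚ.m∸n+n≡m p<l)) e))
        where p<l = ℕₚ.≰⇒> l≰p

    last-defined : ∀ {x} → (∀ t {y} → iter f t x ≡ just y → t < N) →
                   ∃ λ t → ∃ λ y → iter f t x ≡ just y × f y ≡ nothing
    last-defined {x} bounded = go N 0 refl ℕₚ.≤-refl
      where
      go : ∀ fuel t {y} → iter f t x ≡ just y → N ≤ t + fuel → ∃ λ t → ∃ λ y → iter f t x ≡ just y × f y ≡ nothing
      go zero       t e N≤t = ⊥-elim (ℕₚ.<⇒≱ (bounded t e) (subst (N ≤_) (ℕₚ.+-identityʳ t) N≤t))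
      go (suc fuel) t {y} e N≤ with f y in fy
      ... | nothing = t , y , e , fy
      ... | just y′ = go fuel (suc t) (trans (cong (_>>= f) e) fy) (subst (N ≤_) (ℕₚ.+-suc t fuel) N≤)

    ∈-orbit⁺ : ∀ {j p i} l → l < p → iter f l j ≡ just i → lookup (orbit f j p) i ≡ true
    ∈-orbit⁺ {j} {p} {i} l l<p e = trans (Vecₚ.lookup∘tabulate _ i)
      (dec-true (any? λ l → ≡-dec _≟ᶠ_ (iter f (toℕ l) j) (just i))
                (fromℕ< l<p , subst (λ t → iter f t j ≡ just i) (sym (toℕ-fromℕ< l<p)) e))

    ∈-orbit⁻ : ∀ {j} p {i} → lookup (orbit f j p) i ≡ true → ∃ λ l → l < p × iter f l j ≡ just i
    ∈-orbit⁻ {j} p {i} e = witness (any? λ l → ≡-dec _≟ᶠ_ (iter f (toℕ l) j) (just i))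
                                     (trans (sym (Vecₚ.lookup∘tabulate _ i)) e)
      where
      witness : (d : Dec (∃ λ (l : Fin p) → iter f (toℕ l) j ≡ just i)) → does d ≡ true →
                ∃ λ l → l < p × iter f l j ≡ just i
      witness (yes (l , e)) _ = toℕ l , toℕ<n l , e

  module PartialInjection {N : ℕ} (f : Fin N → Maybe (Fin N))
                          (f-injective : ∀ {x x′ y} → f x ≡ just y → f x′ ≡ just y → x ≡ x′) where
    open Iterate f

    iter-cancel : ∀ c a b {x x′ y} → iter f (c + a) x ≡ just y → iter f (c + b) x′ ≡ just y →
                  ∃ λ y′ → iter f a x ≡ just y′ × iter f b x′ ≡ just y′
    iter-cancel zero    a b e e′ = _ , e , e′
    iter-cancel (suc c) a b e e′ with iter-suc-last (c + a) e | iter-suc-last (c + b) e′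
    ... | u , eu , fu | u′ , eu′ , fu′ with refl ← f-injective fu fu′ = iter-cancel c a b eu eu′

    -- Pigeonhole on the N + 1 iterates 0, …, N of x.
    iterate-repeats : ∀ x → (∀ t → t ≤ N → ∃ λ y → iter f t x ≡ just y) →
                      ∃ λ s → ∃ λ d → s + suc d ≤ N × ∃ λ y → iter f s x ≡ just y × iter f (s + suc d) x ≡ just y
    iterate-repeats x defined
      with s₁ , s₂ , s₁<s₂ , eq ← pigeonhole (ℕₚ.n<1+n N) (λ (s : Fin (suc N)) → fromMaybe x (iter f (toℕ s) x))
      with y₁ , e₁ ← defined (toℕ s₁) (ℕₚ.≤-pred (toℕ<n s₁))
      with y₂ , e₂ ← defined (toℕ s₂) (ℕₚ.≤-pred (toℕ<n s₂))
      = toℕ s₁ , d , subst (_≤ N) (sym s₂≡) (ℕₚ.≤-pred (toℕ<n s₂)) , y₁ , e₁ , e₂′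
      where
      d = toℕ s₂ ∸ suc (toℕ s₁)
      s₂≡ : toℕ s₁ + suc d ≡ toℕ s₂
      s₂≡ = trans (ℕₚ.+-suc (toℕ s₁) d) (ℕₚ.m+[n∸m]≡n (toℕ-mono-< s₁<s₂))
      e₂′ : iter f (toℕ s₁ + suc d) x ≡ just y₁
      e₂′ = trans (cong (λ t → iter f t x) s₂≡)
                  (trans e₂ (cong just (trans (cong (fromMaybe x) (sym e₂)) (trans (sym eq) (cong (fromMaybe x) e₁)))))

    -- By injectivity the first repetition along the orbit of c ∉ image f would have to be c itself.
    iter-from-nonImage-< : ∀ {c} → (∀ x → f x ≢ just c) → ∀ t {y} → iter f t c ≡ just y → t < N
    iter-from-nonImage-< {c} c∉img t {y} e with N ≤? t
    ... | no N≰t = ℕₚ.≰⇒> N≰t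
    ... | yes N≤t
      with s , d , _ , y′ , e₁ , e₂ ← iterate-repeats c (λ t′ t′≤N →
             iter-prefix t′ (t ∸ t′) (trans (cong (λ u → iter f u c) (ℕₚ.m∸n+n≡m (ℕₚ.≤-trans t′≤N N≤t))) e))
      with _ , refl , e₃ ← iter-cancel s 0 (suc d) (trans (cong (λ u → iter f u c) (ℕₚ.+-identityʳ s)) e₁) e₂
      with u , _ , fu ← iter-suc-last d e₃
      = ⊥-elim (c∉img u fu)

    period-bounded : ∀ a {j} → iter f (suc a) j ≡ just j → Σ (Fin N) λ p → iter f (suc (toℕ p)) j ≡ just j
    period-bounded a {j} per
      with s , d , s+d<N , y , e₁ , e₂ ← iterate-repeats j (λ t _ →
             iter-prefix t (t * suc a ∸ t) (trans (cong (λ u → iter f u j) (ℕₚ.m∸n+n≡m (ℕₚ.m≤m*n t (suc a))))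
                                                  (iter-multiple a per t)))
      with _ , refl , e₃ ← iter-cancel s 0 (suc d) (trans (cong (λ u → iter f u j) (ℕₚ.+-identityʳ s)) e₁) e₂
      = fromℕ< d<N , trans (cong (λ u → iter f (suc u) j) (toℕ-fromℕ< d<N)) e₃
      where
      d<N : d < N
      d<N = ℕₚ.≤-trans (s≤s (ℕₚ.m≤n+m d s)) (subst (_≤ N) (ℕₚ.+-suc s d) s+d<N)

  -- Cycles are counted through their leaders, the key-minimal points; the key is a parameter
  -- so that the leader of a cycle can be steered into a chosen part of the domain.
  module CycleCount {N : ℕ} (f : Fin N → Maybe (Fin N)) (key : Fin N → ℕ)
                    (key-injective : ∀ {i j} → key i ≡ key j → i ≡ j) where
    open Iterate f

    Periodic : Fin N → Set
    Periodic j = Σ (Fin N) λ p → iter f (suc (toℕ p)) j ≡ just j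

    periodic? : Decidable Periodic
    periodic? j = any? λ p → ≡-dec _≟ᶠ_ (iter f (suc (toℕ p)) j) (just j)

    KeyBelow : Fin N → Maybe (Fin N) → Set
    KeyBelow j nothing  = ⊤
    KeyBelow j (just i) = key j ≤ key i

    keyBelow? : ∀ j m → Dec (KeyBelow j m)
    keyBelow? j nothing  = yes tt
    keyBelow? j (just i) = key j ≤? key i

    KeyMinimal : Fin N → Set
    KeyMinimal j = ∀ (l : Fin N) → KeyBelow j (iter f (toℕ l) j)

    Leader : Fin N → Set
    Leader j = Periodic j × KeyMinimal j

    leader? : Decidable Leader
    leader? j = periodic? j ×-dec all? λ l → keyBelow? j (iter f (toℕ l) j)

    keyMinimal-≤ : ∀ {j i} → KeyMinimal j → (l : Fin N) → iter f (toℕ l) j ≡ just i → key j ≤ key i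
    keyMinimal-≤ {j} min l e = subst (KeyBelow j) e (min l)

    keyMinimal-intro : ∀ {j} → (∀ (l : Fin N) {i} → iter f (toℕ l) j ≡ just i → key j ≤ key i) → KeyMinimal j
    keyMinimal-intro {j} h l with iter f (toℕ l) j in eq
    ... | nothing = tt
    ... | just i  = h l eq

    periodic-iter-bounded : ∀ {j} → Periodic j → ∀ l {i} → iter f l j ≡ just i →
                            Σ (Fin N) λ l′ → iter f (toℕ l′) j ≡ just i
    periodic-iter-bounded {j} (p , per) l e with l′ , l′≤p , e′ ← iter-periodic-reduce (toℕ p) per l e =
      fromℕ< l′<N , subst (λ t → iter f t j ≡ _) (sym (toℕ-fromℕ< l′<N)) e′
      where l′<N = ℕₚ.≤-<-trans l′≤p (toℕ<n p)

    keyMinimum : ∀ {p} (P : Fin N → Set p) → Decidable P → (xs : List (Fin N)) →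
                 (∀ i → i ∈ xs → ¬ P i) ⊎ (Σ (Fin N) λ j → P j × (∀ i → i ∈ xs → P i → key j ≤ key i))
    keyMinimum P P? [] = inj₁ λ _ ()
    keyMinimum P P? (x ∷ xs) with P? x | keyMinimum P P? xs
    ... | no ¬px | inj₁ none = inj₁ λ { _ (here refl) → ¬px ; i (there q) → none i q }
    ... | no ¬px | inj₂ (j , pj , min) =
            inj₂ (j , pj , λ { _ (here refl) px → ⊥-elim (¬px px) ; i (there q) → min i q })
    ... | yes px | inj₁ none =
            inj₂ (x , px , λ { _ (here refl) _ → ℕₚ.≤-refl ; i (there q) pi → ⊥-elim (none i q pi) })
    ... | yes px | inj₂ (j , pj , min) with key x ≤? key j
    ...   | yes x≤j = inj₂ (x , px , λ { _ (here refl) _ → ℕₚ.≤-refl ; i (there q) pi → ℕₚ.≤-trans x≤j (min i q pi) })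
    ...   | no  x≰j = inj₂ (j , pj , λ { _ (here refl) _ → ℕₚ.<⇒≤ (ℕₚ.≰⇒> x≰j) ; i (there q) → min i q })

    orbitOf : Fin N → Vec Bool N
    orbitOf j = orbit f j N

    orbitOf-self : ∀ j → lookup (orbitOf j) j ≡ true
    orbitOf-self j = ∈-orbit⁺ 0 (ℕₚ.≤-<-trans z≤n (toℕ<n j)) refl

    leader-isCycle : ∀ {j} → Leader j → IsCycle f (orbitOf j)
    leader-isCycle {j} ((p , per) , _) = j , p , per , subset-ext ⊆ ⊇
      where
      ⊆ : ∀ i → lookup (orbitOf j) i ≡ true → lookup (orbit f j (suc (toℕ p))) i ≡ true
      ⊆ i t with l , _ , e ← ∈-orbit⁻ N t with l′ , l′≤p , e′ ← iter-periodic-reduce (toℕ p) per l e =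
        ∈-orbit⁺ l′ (s≤s l′≤p) e′
      ⊇ : ∀ i → lookup (orbit f j (suc (toℕ p))) i ≡ true → lookup (orbitOf j) i ≡ true
      ⊇ i t with l , l<p , e ← ∈-orbit⁻ _ t = ∈-orbit⁺ l (ℕₚ.≤-trans l<p (toℕ<n p)) e

    isCycle-leader : ∀ {C} → IsCycle f C → Σ (Fin N) λ j → Leader j × orbitOf j ≡ C
    isCycle-leader {C} (j₀ , p₀ , per₀ , refl)
      with keyMinimum (λ i → lookup C i ≡ true) (λ i → lookup C i Boolₚ.≟ true) (allFin N)
    ... | inj₁ none = ⊥-elim (none j₀ (∈-allFin j₀) (∈-orbit⁺ {p = suc (toℕ p₀)} 0 (s≤s z≤n) refl))
    ... | inj₂ (j , j∈C , min) with a , a<P , e₀ ← ∈-orbit⁻ (suc (toℕ p₀)) j∈C = j , (perʲ , minʲ) , subset-ext ⊆ ⊇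
      where
      P = suc (toℕ p₀)
      perʲ : Periodic j
      perʲ = p₀ , trans (sym (iter-+ a P e₀))
                        (trans (cong (λ t → iter f t j₀) (ℕₚ.+-comm P a)) (trans (iter-+ P a per₀) e₀))
      return : iter f (P ∸ a) j ≡ just j₀
      return = trans (sym (iter-+ a (P ∸ a) e₀)) (trans (cong (λ t → iter f t j₀) (ℕₚ.m∸n+n≡m (ℕₚ.<⇒≤ a<P))) per₀)
      ⊆ : ∀ i → lookup (orbitOf j) i ≡ true → lookup C i ≡ true
      ⊆ i t with l , _ , e ← ∈-orbit⁻ N t
            with l′ , l′≤p , e′ ← iter-periodic-reduce (toℕ p₀) per₀ (l + a) (iter-trans a l e₀ e) =
        ∈-orbit⁺ l′ (s≤s l′≤p) e′
      ⊇ : ∀ i → lookup C i ≡ true → lookup (orbitOf j) i ≡ true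
      ⊇ i t with l , _ , e ← ∈-orbit⁻ P t
            with l′ , e′ ← periodic-iter-bounded perʲ (l + (P ∸ a)) (iter-trans (P ∸ a) l return e) =
        ∈-orbit⁺ (toℕ l′) (toℕ<n l′) e′
      minʲ : KeyMinimal j
      minʲ = keyMinimal-intro λ l e → min _ (∈-allFin _) (⊆ _ (∈-orbit⁺ (toℕ l) (toℕ<n l) e))

    orbitOf-injective : ∀ {j j′} → Leader j → Leader j′ → orbitOf j ≡ orbitOf j′ → j ≡ j′
    orbitOf-injective {j} {j′} (_ , min) (_ , min′) eq = key-injective (ℕₚ.≤-antisym
      (in-orbit-≤ min (subst (λ C → lookup C j′ ≡ true) (sym eq) (orbitOf-self j′)))
      (in-orbit-≤ min′ (subst (λ C → lookup C j ≡ true) eq (orbitOf-self j))))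
      where
      in-orbit-≤ : ∀ {a b} → KeyMinimal a → lookup (orbitOf a) b ≡ true → key a ≤ key b
      in-orbit-≤ {a} min t with l , l<N , e ← ∈-orbit⁻ N t =
        keyMinimal-≤ min (fromℕ< l<N) (subst (λ u → iter f u a ≡ _) (sym (toℕ-fromℕ< l<N)) e)

    cycles≡#leaders : cycles f ≡ length (filter leader? (allFin N))
    cycles≡#leaders = sym (length-filter-bijection leader? (isCycle? f) orbitOf (allFin N) (allSubsets N)
      (allFin⁺ N) (allSubsets-unique N)
      (λ _ ℓ → ∈-allSubsets _ , leader-isCycle ℓ)
      (λ _ c → let j , ℓ , e = isCycle-leader c in j , ∈-allFin j , ℓ , e)
      (λ _ _ ℓ ℓ′ → orbitOf-injective ℓ ℓ′))

  -- h is the first-return map of f to the image of the embedding e: a step of h from s is the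
  -- first visit of the f-orbit of e s to the image of e, and h is undefined where f is.
  module FirstReturn {N M : ℕ} (f : Fin N → Maybe (Fin N)) (h : Fin M → Maybe (Fin M)) (e : Fin M → Fin N)
    (e-injective : ∀ {s s′} → e s ≡ e s′ → s ≡ s′)
    (h-just : ∀ {s s′} → h s ≡ just s′ → ∃ λ a → iter f (suc a) (e s) ≡ just (e s′) ×
                (∀ b {y} s″ → b < a → iter f (suc b) (e s) ≡ just y → y ≢ e s″))
    (h-nothing : ∀ {s} → h s ≡ nothing → f (e s) ≡ nothing) where
    open Iterate f
    private module Iterateʰ = Iterate h

    iter-return⇒iter : ∀ p {s s′} → iter h p s ≡ just s′ → ∃ λ a → p ≤ a × iter f a (e s) ≡ just (e s′)
    iter-return⇒iter zero    refl = 0 , z≤n , refl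
    iter-return⇒iter (suc p) eq
      with u , eu , hu ← Iterateʰ.iter-suc-last p eq
      with a , p≤a , r ← iter-return⇒iter p eu
      with a′ , r′ , _ ← h-just hu
      = suc a′ + a , s≤s (ℕₚ.≤-trans p≤a (ℕₚ.m≤n+m a a′)) , iter-trans a (suc a′) r r′

    iter⇒iter-return : ∀ a {s s′} → iter f (suc a) (e s) ≡ just (e s′) → ∃ λ p → iter h (suc p) s ≡ just s′
    iter⇒iter-return a = go a (<-wellFounded a)
      where
      go : ∀ a → Acc _<_ a → ∀ {s s′} → iter f (suc a) (e s) ≡ just (e s′) → ∃ λ p → iter h (suc p) s ≡ just s′
      go a (acc rs) {s} {s′} r with h s in hs
      ... | nothing with () ← trans (sym r) (iter-suc-first-nothing a (h-nothing hs))
      ... | just s₁ with a₁ , r₁ , avoids ← h-just hs with ℕₚ.<-cmp a a₁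
      ...   | tri< a<a₁ _ _ = ⊥-elim (avoids a s′ a<a₁ r refl)
      ...   | tri≈ _ refl _ = 0 , trans hs (cong just (e-injective (just-injective (trans (sym r₁) r))))
      ...   | tri> _ _ a₁<a
        with p , rp ← go (a ∸ suc a₁) (rs (ℕₚ.∸-monoʳ-< {o = 0} (s≤s z≤n) a₁<a))
                         (trans (sym (iter-+ (suc a₁) (suc (a ∸ suc a₁)) r₁))
                                (trans (cong (λ u → iter f (suc u) (e s)) (ℕₚ.m∸n+n≡m a₁<a)) r))
        = suc p , trans (Iterateʰ.iter-suc-first (suc p) hs) rp

  module FreeIndices {m n k : ℕ} (m≤n : m ≤ n) (β : Fin k → Fin m)
                     (β-injective : ∀ {l l′} → β l ≡ β l′ → l ≡ l′) where

    βₙ : Fin k → Fin n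
    βₙ l = inject≤ (β l) m≤n

    toℕ-βₙ : ∀ l → toℕ (βₙ l) ≡ toℕ (β l)
    toℕ-βₙ l = toℕ-inject≤ (β l) m≤n

    βₙ-injective : ∀ {l l′} → toℕ (βₙ l) ≡ toℕ (βₙ l′) → l ≡ l′
    βₙ-injective {l} {l′} e = β-injective (toℕ-injective (trans (sym (toℕ-βₙ l)) (trans e (toℕ-βₙ l′))))

    InS : Fin n → Set
    InS j = ∃ λ l → βₙ l ≡ j

    InS? : Decidable InS
    InS? j = any? λ l → βₙ l ≟ᶠ j

    Inβ : Fin m → Set
    Inβ i = ∃ λ l → β l ≡ i

    freeCols : List (Fin n)
    freeCols = filter (λ j → ¬? (InS? j)) (allFin n)

    freeRows : List (Fin m)
    freeRows = rowsCompl β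

    freeCols-unique : Unique freeCols
    freeCols-unique = filter⁺ (λ j → ¬? (InS? j)) (allFin⁺ n)

    freeRows-unique : Unique freeRows
    freeRows-unique = filter⁺ (λ i → ¬? (any? λ l → β l ≟ᶠ i)) (allFin⁺ m)

    ∈-freeCols⁻ : ∀ {j} → j ∈ freeCols → ¬ InS j
    ∈-freeCols⁻ p = ∈-filter⁻ (λ j → ¬? (InS? j)) {xs = allFin n} p .proj₂

    ∈-freeCols⁺ : ∀ {j} → ¬ InS j → j ∈ freeCols
    ∈-freeCols⁺ {j} = ∈-filter⁺ (λ j → ¬? (InS? j)) (∈-allFin j)

    ∈-freeRows⁻ : ∀ {i} → i ∈ freeRows → ¬ Inβ i
    ∈-freeRows⁻ p = ∈-filter⁻ (λ i → ¬? (any? λ l → β l ≟ᶠ i)) {xs = allFin m} p .proj₂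

    ∈-freeRows⁺ : ∀ {i} → ¬ Inβ i → i ∈ freeRows
    ∈-freeRows⁺ {i} = ∈-filter⁺ (λ i → ¬? (any? λ l → β l ≟ᶠ i)) (∈-allFin i)

    private
      NotInβ : ℕ → Set
      NotInβ x = ¬ (∃ λ l → toℕ (β l) ≡ x)

      notInβ? : Decidable NotInβ
      notInβ? x = ¬? (any? λ l → toℕ (β l) ℕ.≟ x)

      colsBeyond : List ℕ
      colsBeyond = filter notInβ? (applyUpTo (m +_) (n ∸ m))

      -- Since S ⊆ N_m, the free columns begin with the free rows; all later ones are ≥ m.
      freeCols-toℕ : map toℕ freeCols ≡ map toℕ freeRows ++ colsBeyond
      freeCols-toℕ = begin
        map toℕ freeCols
          ≡⟨ map-filter toℕ (λ j → ¬? (InS? j)) notInβ? (λ j → does-⇔ (mk⇔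
               (λ j∉S (l , e) → j∉S (l , toℕ-injective (trans (toℕ-βₙ l) e)))
               (λ j∉β (l , e) → j∉β (l , trans (sym (toℕ-βₙ l)) (cong toℕ e))))
               (¬? (InS? j)) (notInβ? (toℕ j))) (allFin n) ⟩
        filter notInβ? (map toℕ (allFin n))
          ≡⟨ cong (filter notInβ?) (trans (map-toℕ-allFin n)
               (trans (cong upTo (sym (ℕₚ.m+[n∸m]≡n m≤n))) (applyUpTo-+ (λ x → x) m (n ∸ m)))) ⟩
        filter notInβ? (upTo m ++ applyUpTo (m +_) (n ∸ m))
          ≡⟨ Listₚ.filter-++ notInβ? (upTo m) _ ⟩
        filter notInβ? (upTo m) ++ colsBeyond
          ≡⟨ cong (_++ colsBeyond) (trans (map-filter toℕ _ notInβ? (λ i → does-⇔ (mk⇔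
               (λ i∉β (l , e) → i∉β (l , toℕ-injective e)) (λ i∉β (l , e) → i∉β (l , cong toℕ e)))
               (¬? (any? λ l → β l ≟ᶠ i)) (notInβ? (toℕ i))) (allFin m))
               (cong (filter notInβ?) (map-toℕ-allFin m))) ⟨
        map toℕ freeRows ++ colsBeyond ∎
        where
        open ≡-Reasoning

      colsBeyond-≥ : ∀ {x} → x ∈ colsBeyond → m ≤ x
      colsBeyond-≥ p with y , _ , refl ← ∈-applyUpTo⁻ (m +_) (∈-filter⁻ notInβ? {xs = applyUpTo (m +_) (n ∸ m)} p .proj₁) =
        ℕₚ.m≤m+n m y

    nth-freeCols-< : ∀ s → s < length freeRows → Maybe.map toℕ (nth freeCols s) ≡ Maybe.map toℕ (nth freeRows s)
    nth-freeCols-< s s<r = begin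
      Maybe.map toℕ (nth freeCols s)             ≡⟨ nth-map toℕ freeCols s ⟨
      nth (map toℕ freeCols) s                   ≡⟨ cong (λ xs → nth xs s) freeCols-toℕ ⟩
      nth (map toℕ freeRows ++ colsBeyond) s     ≡⟨ nth-++ˡ (map toℕ freeRows) colsBeyond
                                                      (subst (s <_) (sym (Listₚ.length-map toℕ freeRows)) s<r) ⟩
      nth (map toℕ freeRows) s                   ≡⟨ nth-map toℕ freeRows s ⟩
      Maybe.map toℕ (nth freeRows s)             ∎
      where open ≡-Reasoning

    nth-freeCols-≥ : ∀ s {j} → nth freeCols s ≡ just j → length freeRows ≤ s → m ≤ toℕ j
    nth-freeCols-≥ s {j} e r≤s = colsBeyond-≥ (nth-∈ colsBeyond (s ∸ r) (begin
      nth colsBeyond (s ∸ r)                               ≡⟨ nth-++ʳ (map toℕ freeRows) colsBeyond (s ∸ r) ⟨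
      nth (map toℕ freeRows ++ colsBeyond) (length (map toℕ freeRows) + (s ∸ r))
        ≡⟨ cong (λ t → nth (map toℕ freeRows ++ colsBeyond) (t + (s ∸ r))) (Listₚ.length-map toℕ freeRows) ⟩
      nth (map toℕ freeRows ++ colsBeyond) (r + (s ∸ r))   ≡⟨ cong (nth (map toℕ freeRows ++ colsBeyond)) (ℕₚ.m+[n∸m]≡n r≤s) ⟩
      nth (map toℕ freeRows ++ colsBeyond) s               ≡⟨ cong (λ xs → nth xs s) freeCols-toℕ ⟨
      nth (map toℕ freeCols) s                             ≡⟨ nth-map toℕ freeCols s ⟩
      Maybe.map toℕ (nth freeCols s)                       ≡⟨ cong (Maybe.map toℕ) e ⟩
      just (toℕ j)                                         ∎))
      where
      open ≡-Reasoning
      r = length freeRows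

    lookup-freeRows-∉β : ∀ r → ¬ Inβ (List.lookup freeRows r)
    lookup-freeRows-∉β r = ∈-freeRows⁻ (∈-lookup r)

    rowCases : ∀ i → Inβ i ⊎ ∃ λ r → List.lookup freeRows r ≡ i
    rowCases i with any? (λ l → β l ≟ᶠ i)
    ... | yes i∈β = inj₁ i∈β
    ... | no  i∉β = let p = ∈-freeRows⁺ i∉β in inj₂ (Any.index p , sym (lookup-index p))

  -- φ is an injection of S into N_n. Hence N_n splits into cycles inside S and chains
  -- c ↦ φ c ↦ … ↦ j running from a point c ∉ φ(S) to a point j ∉ S, and φ* maps the end j of each
  -- chain back to its start c; so y_j is a bijection from N_n ∖ S onto N_n ∖ φ(S).
  module InjectionOnS {m n k : ℕ} (m≤n : m ≤ n) (β : Fin k → Fin m)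
                      (β-injective : ∀ {l l′} → β l ≡ β l′ → l ≡ l′)
                      (g : Fin k → Fin n) (g-injective : ∀ {l l′} → g l ≡ g l′ → l ≡ l′) where
    open FreeIndices m≤n β β-injective

    φ : Fin n → Maybe (Fin n)
    φ = φmap m≤n β g

    φ⁻¹ : Fin n → Maybe (Fin n)
    φ⁻¹ = φinv m≤n β g

    φ̄ : List (Fin n)
    φ̄ = φbar m≤n β g

    y : Fin n → Fin n
    y = yval m≤n β g

    InImage : Fin n → Set
    InImage j = ∃ λ l → g l ≡ j

    φ-just⁻ : ∀ {x z} → φ x ≡ just z → ∃ λ l → βₙ l ≡ x × g l ≡ z
    φ-just⁻ e with l , p , q ← findVal-just⁻ βₙ g e = l , toℕ-injective p , q

    φ-just⁺ : ∀ l → φ (βₙ l) ≡ just (g l)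
    φ-just⁺ l = findVal-just⁺ βₙ g βₙ-injective l refl

    φ⁻¹-just⁻ : ∀ {x z} → φ⁻¹ x ≡ just z → ∃ λ l → g l ≡ x × βₙ l ≡ z
    φ⁻¹-just⁻ e with l , p , q ← findVal-just⁻ g βₙ e = l , toℕ-injective p , q

    φ⁻¹-just⁺ : ∀ l → φ⁻¹ (g l) ≡ just (βₙ l)
    φ⁻¹-just⁺ l = findVal-just⁺ g βₙ (λ e → g-injective (toℕ-injective e)) l refl

    φ⇒φ⁻¹ : ∀ {x z} → φ z ≡ just x → φ⁻¹ x ≡ just z
    φ⇒φ⁻¹ e with l , refl , refl ← φ-just⁻ e = φ⁻¹-just⁺ l

    φ⁻¹⇒φ : ∀ {x z} → φ⁻¹ x ≡ just z → φ z ≡ just x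
    φ⁻¹⇒φ e with l , refl , refl ← φ⁻¹-just⁻ e = φ-just⁺ l

    φ-injective : ∀ {x x′ z} → φ x ≡ just z → φ x′ ≡ just z → x ≡ x′
    φ-injective e e′ with l , refl , refl ← φ-just⁻ e | l′ , refl , q ← φ-just⁻ e′ = cong βₙ (g-injective (sym q))

    φ⁻¹-injective : ∀ {x x′ z} → φ⁻¹ x ≡ just z → φ⁻¹ x′ ≡ just z → x ≡ x′
    φ⁻¹-injective e e′ with l , refl , refl ← φ⁻¹-just⁻ e | l′ , refl , q ← φ⁻¹-just⁻ e′ =
      cong g (βₙ-injective (cong toℕ (sym q)))

    φ-defined⇒InS : ∀ {x z} → φ x ≡ just z → InS x
    φ-defined⇒InS e with l , p , _ ← φ-just⁻ e = l , p

    InS⇒φ-defined : ∀ {x} → InS x → ∃ λ z → φ x ≡ just z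
    InS⇒φ-defined (l , refl) = g l , φ-just⁺ l

    φ-image : ∀ {x z} → φ x ≡ just z → InImage z
    φ-image e with l , _ , q ← φ-just⁻ e = l , q

    open Iterate φ
    private
      module Injφ = PartialInjection φ φ-injective
      module Injφ⁻¹ = PartialInjection φ⁻¹ φ⁻¹-injective
      module Iterφ⁻¹ = Iterate φ⁻¹

    iter-φ⁻¹⇒iter-φ : ∀ t {x z} → iter φ⁻¹ t x ≡ just z → iter φ t z ≡ just x
    iter-φ⁻¹⇒iter-φ zero    refl = refl
    iter-φ⁻¹⇒iter-φ (suc t) e with u , eu , fu ← Iterφ⁻¹.iter-suc-last t e =
      trans (iter-suc-first t (φ⁻¹⇒φ fu)) (iter-φ⁻¹⇒iter-φ t eu)

    iter-φ-from-nonImage-< : ∀ {c} → ¬ InImage c → ∀ t {z} → iter φ t c ≡ just z → t < n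
    iter-φ-from-nonImage-< c∉ = Injφ.iter-from-nonImage-< (λ x e → c∉ (φ-image e))

    iter-φ-inner-InS : ∀ {c a b x z} → iter φ a c ≡ just x → iter φ b c ≡ just z → a < b → InS x
    iter-φ-inner-InS {c} {a} {b} e e′ a<b
      with w , ew ← iter-prefix (suc a) (b ∸ suc a) (trans (cong (λ t → iter φ t c) (ℕₚ.m∸n+n≡m a<b)) e′)
      with u , eu , fu ← iter-suc-last a ew
      = φ-defined⇒InS (subst (λ t → φ t ≡ just w) (just-injective (trans (sym eu) e)) fu)

    back-iter : ∀ {c} → ¬ InImage c → ∀ i fuel {x} → i < fuel → iter φ (suc i) c ≡ just x → back m≤n β g fuel x ≡ c
    back-iter {c} c∉ zero (suc fuel) {x} _ e with φ⁻¹ x | φ⇒φ⁻¹ e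
    ... | _ | refl with inφS? m≤n β g c
    ...   | yes c∈ = ⊥-elim (c∉ c∈)
    ...   | no _   = refl
    back-iter {c} c∉ (suc i) (suc fuel) {x} (s≤s i<fuel) e with u , eu , fu ← iter-suc-last (suc i) e
      with φ⁻¹ x | φ⇒φ⁻¹ fu
    ... | _ | refl with inφS? m≤n β g u
    ...   | yes _  = back-iter c∉ i fuel i<fuel eu
    ...   | no u∉ with w , _ , fw ← iter-suc-last i eu = ⊥-elim (u∉ (φ-image fw))

    y-chainEnd : ∀ {c} i {j} → ¬ InImage c → iter φ (suc i) c ≡ just j → y j ≡ c
    y-chainEnd {c} i {j} c∉ e with inφS? m≤n β g j
    ... | yes _ = back-iter c∉ i n (ℕₚ.<-trans (ℕₚ.n<1+n i) (iter-φ-from-nonImage-< c∉ (suc i) e)) e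
    ... | no j∉ with w , _ , fw ← iter-suc-last i e = ⊥-elim (j∉ (φ-image fw))

    y-nonImage : ∀ {j} → ¬ InImage j → y j ≡ j
    y-nonImage {j} j∉ with inφS? m≤n β g j
    ... | yes j∈ = ⊥-elim (j∉ j∈)
    ... | no _   = refl

    chainStart : ∀ {j} → ¬ InS j → InImage j → ∃ λ c → ∃ λ i → InS c × ¬ InImage c × iter φ (suc i) c ≡ just j
    chainStart {j} j∉S (l₀ , refl) with Iterφ⁻¹.last-defined
           (Injφ⁻¹.iter-from-nonImage-< (λ x e → j∉S (let l , _ , q = φ⁻¹-just⁻ e in l , q)))
    ... | zero  , _ , refl , fj with () ← trans (sym (φ⁻¹-just⁺ l₀)) fj
    ... | suc i , c , e , fc with u , _ , fu ← Iterφ⁻¹.iter-suc-last i e =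
      c , i , (let l , _ , q = φ⁻¹-just⁻ fu in l , q) ,
      (λ (l , q) → case trans (sym (subst (λ t → φ⁻¹ t ≡ just (βₙ l)) q (φ⁻¹-just⁺ l))) fc of λ ()) ,
      iter-φ⁻¹⇒iter-φ (suc i) e

    chainEnd : ∀ {c} → InS c → ¬ InImage c → ∃ λ j → ∃ λ i → ¬ InS j × iter φ (suc i) c ≡ just j
    chainEnd {c} c∈S c∉ with last-defined (iter-φ-from-nonImage-< c∉)
    ... | zero  , _ , refl , fc with () ← trans (sym (InS⇒φ-defined c∈S .proj₂)) fc
    ... | suc i , j , e , fj = j , i , (λ j∈S → case trans (sym (InS⇒φ-defined j∈S .proj₂)) fj of λ ()) , e

    y-cases : ∀ {j} → j ∈ freeCols →
              (¬ InImage j × y j ≡ j) ⊎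
              (∃ λ c → ∃ λ i → InS c × ¬ InImage c × iter φ (suc i) c ≡ just j × y j ≡ c)
    y-cases {j} j∈ with toSum (inφS? m≤n β g j)
    ... | inj₂ j∉ = inj₁ (j∉ , y-nonImage j∉)
    ... | inj₁ j∈img with c , i , c∈S , c∉ , e ← chainStart (∈-freeCols⁻ j∈) j∈img =
      inj₂ (c , i , c∈S , c∉ , e , y-chainEnd i c∉ e)

    y-∉image : ∀ {j} → j ∈ freeCols → ¬ InImage (y j)
    y-∉image j∈ with y-cases j∈
    ... | inj₁ (j∉ , e)                = subst (λ t → ¬ InImage t) (sym e) j∉
    ... | inj₂ (_ , _ , _ , c∉ , _ , e) = subst (λ t → ¬ InImage t) (sym e) c∉

    y-injective : ∀ {j j′} → j ∈ freeCols → j′ ∈ freeCols → y j ≡ y j′ → j ≡ j′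
    y-injective {j} {j′} p p′ eq with y-cases p | y-cases p′
    ... | inj₁ (_ , e) | inj₁ (_ , e′) = trans (sym e) (trans eq e′)
    ... | inj₁ (_ , e) | inj₂ (_ , _ , c∈S , _ , _ , e′) =
      ⊥-elim (∈-freeCols⁻ p (subst InS (trans (sym e′) (trans (sym eq) e)) c∈S))
    ... | inj₂ (_ , _ , c∈S , _ , _ , e) | inj₁ (_ , e′) =
      ⊥-elim (∈-freeCols⁻ p′ (subst InS (trans (sym e) (trans eq e′)) c∈S))
    ... | inj₂ (_ , i , _ , _ , ch , e) | inj₂ (_ , i′ , _ , _ , ch′ , e′)
      with refl ← trans (sym e) (trans eq e′) with ℕₚ.<-cmp i i′
    ...   | tri< i<i′ _ _ = ⊥-elim (∈-freeCols⁻ p (iter-φ-inner-InS ch ch′ (s≤s i<i′)))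
    ...   | tri≈ _ refl _ = just-injective (trans (sym ch) ch′)
    ...   | tri> _ _ i′<i = ⊥-elim (∈-freeCols⁻ p′ (iter-φ-inner-InS ch′ ch (s≤s i′<i)))

    φ̄-∉image : ∀ {x} → x ∈ φ̄ → ¬ InImage x
    φ̄-∉image p with _ , j∈ , refl ← ∈-map⁻ y p = y-∉image j∈

    φ̄-unique : Unique φ̄
    φ̄-unique = unique-map⁺ y y-injective freeCols-unique

    ∈-φ̄ : ∀ {x} → ¬ InImage x → x ∈ φ̄
    ∈-φ̄ {x} x∉ with InS? x
    ... | no  x∉S = subst (_∈ φ̄) (y-nonImage x∉) (∈-map⁺ y (∈-freeCols⁺ x∉S))
    ... | yes x∈S with j , i , j∉S , e ← chainEnd x∈S x∉ =
      subst (_∈ φ̄) (y-chainEnd i x∉ e) (∈-map⁺ y (∈-freeCols⁺ j∉S))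

  module Gluing {m n k : ℕ} (m≤n : m ≤ n) (β : Fin k → Fin m)
                (β-injective : ∀ {l l′} → β l ≡ β l′ → l ≡ l′) where
    open FreeIndices m≤n β β-injective

    glue : (g : Fin k → Fin n) → (Fin (length freeRows) → Fin (length (φbar m≤n β g))) → Fin m → Fin n
    glue g u i with rowCases i
    ... | inj₁ (l , _) = g l
    ... | inj₂ (r , _) = List.lookup (φbar m≤n β g) (u r)

    module Glued (g : Fin k → Fin n) (g-injective : ∀ {l l′} → g l ≡ g l′ → l ≡ l′)
                 (u : Fin (length freeRows) → Fin (length (φbar m≤n β g)))
                 (u-injective : ∀ {r r′} → u r ≡ u r′ → r ≡ r′) where
      open InjectionOnS m≤n β β-injective g g-injective

      v : Fin m → Fin n
      v = glue g u

      v-β : ∀ l → v (β l) ≡ g l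
      v-β l with rowCases (β l)
      ... | inj₁ (l′ , e) = cong g (β-injective e)
      ... | inj₂ (r , e)  = ⊥-elim (lookup-freeRows-∉β r (l , sym e))

      v-freeRow : ∀ r → v (List.lookup freeRows r) ≡ List.lookup φ̄ (u r)
      v-freeRow r with rowCases (List.lookup freeRows r)
      ... | inj₁ r∈β     = ⊥-elim (lookup-freeRows-∉β r r∈β)
      ... | inj₂ (r′ , e) = cong (λ t → List.lookup φ̄ (u t)) (lookup-injective freeRows-unique e)

      v-injective : ∀ {i i′} → v i ≡ v i′ → i ≡ i′
      v-injective {i} {i′} e with rowCases i | rowCases i′
      ... | inj₁ (l , refl) | inj₁ (l′ , refl) = cong β (g-injective e)
      ... | inj₁ (l , refl) | inj₂ (r , refl)  = ⊥-elim (φ̄-∉image (∈-lookup (u r)) (l , e))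
      ... | inj₂ (r , refl) | inj₁ (l , refl)  = ⊥-elim (φ̄-∉image (∈-lookup (u r)) (l , sym e))
      ... | inj₂ (r , refl) | inj₂ (r′ , refl) = cong (List.lookup freeRows) (u-injective (lookup-injective φ̄-unique e))

      ψ : Fin n → Maybe (Fin n)
      ψ = injMap (lookup (tabulate v))

      ψ-just⁺ : ∀ i {x} → toℕ i ≡ toℕ x → ψ x ≡ just (v i)
      ψ-just⁺ i e = trans (findVal-just⁺ (λ i → i) _ toℕ-injective i e) (cong just (Vecₚ.lookup∘tabulate v i))

      ψ-just⁻ : ∀ {x z} → ψ x ≡ just z → ∃ λ i → toℕ i ≡ toℕ x × v i ≡ z
      ψ-just⁻ e with i , p , q ← findVal-just⁻ (λ i → i) _ e = i , p , trans (sym (Vecₚ.lookup∘tabulate v i)) q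

      ψ-nothing : ∀ {x} → m ≤ toℕ x → ψ x ≡ nothing
      ψ-nothing {x} m≤x with ψ x in eq
      ... | nothing = refl
      ... | just _ with i , p , _ ← ψ-just⁻ eq = ⊥-elim (ℕₚ.<⇒≱ (subst (_< m) p (toℕ<n i)) m≤x)

      ψ-injective : ∀ {x x′ z} → ψ x ≡ just z → ψ x′ ≡ just z → x ≡ x′
      ψ-injective e e′ with i , p , refl ← ψ-just⁻ e | i′ , p′ , q ← ψ-just⁻ e′ =
        toℕ-injective (trans (sym p) (trans (cong toℕ (v-injective (sym q))) p′))

      φ⊆ψ : ∀ {x z} → φ x ≡ just z → ψ x ≡ just z
      φ⊆ψ e with l , refl , refl ← φ-just⁻ e = trans (ψ-just⁺ (β l) (sym (toℕ-βₙ l))) (cong just (v-β l))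

      iter-φ⊆iter-ψ : ∀ t {x z} → iter φ t x ≡ just z → iter ψ t x ≡ just z
      iter-φ⊆iter-ψ zero    e = e
      iter-φ⊆iter-ψ (suc t) e with w , ew , fw ← Iterate.iter-suc-last φ t e =
        trans (cong (_>>= ψ) (iter-φ⊆iter-ψ t ew)) (φ⊆ψ fw)

      χ : Fin (length φ̄) → Maybe (Fin (length φ̄))
      χ = injMap u

      χ-injective : ∀ {s s′ t} → χ s ≡ just t → χ s′ ≡ just t → s ≡ s′
      χ-injective e e′ with r , p , refl ← findVal-just⁻ (λ r → r) u e | r′ , p′ , q ← findVal-just⁻ (λ r → r) u e′ =
        toℕ-injective (trans (sym p) (trans (cong toℕ (u-injective (sym q))) p′))

      -- φ̄(N_n) is indexed by the free columns, so its positions name points of N_n ∖ S.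
      position : Fin (length φ̄) → Fin n
      position s = List.lookup freeCols (Fin.cast (Listₚ.length-map y freeCols) s)

      nth-position : ∀ s → nth freeCols (toℕ s) ≡ just (position s)
      nth-position s = subst (λ t → nth freeCols t ≡ just (position s)) (toℕ-cast (Listₚ.length-map y freeCols) s)
                             (nth-lookup freeCols _)

      position-injective : ∀ {s s′} → position s ≡ position s′ → s ≡ s′
      position-injective {s} {s′} eq = toℕ-injective (trans (sym (toℕ-cast (Listₚ.length-map y freeCols) s))
        (trans (cong toℕ (lookup-injective freeCols-unique eq)) (toℕ-cast (Listₚ.length-map y freeCols) s′)))

      position-∉S : ∀ s → ¬ InS (position s)
      position-∉S s = ∈-freeCols⁻ (∈-lookup _)

      position-onto : ∀ {x} → ¬ InS x → ∃ λ s → position s ≡ x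
      position-onto {x} x∉S = s , just-injective (begin
        just (position s)                          ≡⟨ nth-position s ⟨
        nth freeCols (toℕ s)                       ≡⟨ cong (nth freeCols) (toℕ-cast _ i) ⟩
        nth freeCols (toℕ i)                       ≡⟨ nth-lookup freeCols i ⟩
        just (List.lookup freeCols i)              ≡⟨ cong just (lookup-index x∈) ⟨
        just x                                     ∎)
        where
        open ≡-Reasoning
        x∈ = ∈-freeCols⁺ x∉S
        i = Any.index x∈
        s = Fin.cast (sym (Listₚ.length-map y freeCols)) i

      lookup-φ̄ : ∀ s → List.lookup φ̄ s ≡ y (position s)
      lookup-φ̄ s = just-injective (begin
        just (List.lookup φ̄ s)              ≡⟨ nth-lookup φ̄ s ⟨
        nth φ̄ (toℕ s)                      ≡⟨ nth-map y freeCols (toℕ s) ⟩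
        Maybe.map y (nth freeCols (toℕ s))  ≡⟨ cong (Maybe.map y) (nth-position s) ⟩
        just (y (position s))               ∎)
        where open ≡-Reasoning

      private
        ψ-position : ∀ {s r} → toℕ r ≡ toℕ s → ψ (position s) ≡ just (y (position (u r)))
        ψ-position {s} {r} r≡s = trans (ψ-just⁺ (List.lookup freeRows r) (sym same))
                                       (cong just (trans (v-freeRow r) (lookup-φ̄ (u r))))
          where
          same : toℕ (position s) ≡ toℕ (List.lookup freeRows r)
          same = just-injective (begin
            just (toℕ (position s))                       ≡⟨ cong (Maybe.map toℕ) (nth-position s) ⟨
            Maybe.map toℕ (nth freeCols (toℕ s))          ≡⟨ nth-freeCols-< (toℕ s) (subst (_< _) r≡s (toℕ<n r)) ⟩
            Maybe.map toℕ (nth freeRows (toℕ s))          ≡⟨ cong (λ t → Maybe.map toℕ (nth freeRows t)) r≡s ⟨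
            Maybe.map toℕ (nth freeRows (toℕ r))          ≡⟨ cong (Maybe.map toℕ) (nth-lookup freeRows r) ⟩
            just (toℕ (List.lookup freeRows r))           ∎)
            where open ≡-Reasoning

      χ-just : ∀ {s s′} → χ s ≡ just s′ → ∃ λ a → iter ψ (suc a) (position s) ≡ just (position s′) ×
                 (∀ b {x} s″ → b < a → iter ψ (suc b) (position s) ≡ just x → x ≢ position s″)
      χ-just {s} e with r , r≡s , refl ← findVal-just⁻ (λ r → r) u e
        with y-cases (∈-lookup {xs = freeCols} (Fin.cast (Listₚ.length-map y freeCols) (u r)))
      ... | inj₁ (_ , y≡) = 0 , trans (ψ-position r≡s) (cong just y≡) , λ _ _ ()
      ... | inj₂ (c , i , c∈S , _ , chain , y≡) =
        suc i , trans (Iterate.iter-suc-first ψ (suc i) step) (iter-φ⊆iter-ψ (suc i) chain) , avoids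
        where
        step = trans (ψ-position r≡s) (cong just y≡)
        avoids : ∀ b {x} s″ → b < suc i → iter ψ (suc b) (position s) ≡ just x → x ≢ position s″
        avoids zero    s″ _ e₀ refl = position-∉S s″ (subst InS (just-injective (trans (sym step) e₀)) c∈S)
        avoids (suc b) s″ (s≤s b<i) eb refl
          with w , ew ← Iterate.iter-prefix φ (suc b) (i ∸ b)
                 (trans (cong (λ t → iter φ t c) (trans (ℕₚ.+-comm (i ∸ b) (suc b)) (cong suc (ℕₚ.m+[n∸m]≡n (ℕₚ.<⇒≤ b<i))))) chain)
          = position-∉S s″ (subst InS (just-injective (trans (sym (iter-φ⊆iter-ψ (suc b) ew))
                              (trans (sym (Iterate.iter-suc-first ψ (suc b) step)) eb)))
                             (iter-φ-inner-InS ew chain (s≤s b<i)))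

      χ-nothing : ∀ {s} → χ s ≡ nothing → ψ (position s) ≡ nothing
      χ-nothing {s} e = ψ-nothing (nth-freeCols-≥ (toℕ s) (nth-position s) beyond)
        where
        beyond : length freeRows ≤ toℕ s
        beyond with length freeRows ≤? toℕ s
        ... | yes r≤s = r≤s
        ... | no  r≰s = ⊥-elim (findVal-nothing⁻ (λ r → r) u e (fromℕ< (ℕₚ.≰⇒> r≰s)) (toℕ-fromℕ< (ℕₚ.≰⇒> r≰s)))

  module GluedCycles {m n k : ℕ} (m≤n : m ≤ n) (β : Fin k → Fin m)
    (β-injective : ∀ {l l′} → β l ≡ β l′ → l ≡ l′)
    (g : Fin k → Fin n) (g-injective : ∀ {l l′} → g l ≡ g l′ → l ≡ l′)
    (u : Fin (length (rowsCompl β)) → Fin (length (φbar m≤n β g)))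
    (u-injective : ∀ {r r′} → u r ≡ u r′ → r ≡ r′) where
    open FreeIndices m≤n β β-injective
    open InjectionOnS m≤n β β-injective g g-injective
    open Gluing.Glued m≤n β β-injective g g-injective u u-injective

    -- Keys placing S after its complement: a ψ-cycle that leaves S then has its leader outside S.
    key : Fin n → ℕ
    key x with InS? x
    ... | yes _ = n + toℕ x
    ... | no  _ = toℕ x

    key-InS : ∀ {x} → InS x → key x ≡ n + toℕ x
    key-InS {x} x∈S with InS? x
    ... | yes _   = refl
    ... | no  x∉S = ⊥-elim (x∉S x∈S)

    key-∉S : ∀ {x} → ¬ InS x → key x ≡ toℕ x
    key-∉S {x} x∉S with InS? x
    ... | yes x∈S = ⊥-elim (x∉S x∈S)
    ... | no  _   = refl

    key-injective : ∀ {x x′} → key x ≡ key x′ → x ≡ x′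
    key-injective {x} {x′} eq with InS? x | InS? x′
    ... | yes _ | yes _ = toℕ-injective (ℕₚ.+-cancelˡ-≡ n _ _ eq)
    ... | no _  | no _  = toℕ-injective eq
    ... | yes _ | no _  = ⊥-elim (ℕₚ.<⇒≱ (toℕ<n x′) (subst (n ≤_) eq (ℕₚ.m≤m+n n (toℕ x))))
    ... | no _  | yes _ = ⊥-elim (ℕₚ.<⇒≱ (toℕ<n x) (subst (n ≤_) (sym eq) (ℕₚ.m≤m+n n (toℕ x′))))

    private
      module Cψ = CycleCount ψ key key-injective
      module Cφ = CycleCount φ toℕ toℕ-injective
      module Cχ = CycleCount χ (λ s → toℕ (position s)) (λ e → position-injective (toℕ-injective e))
      module Iterφ = Iterate φ
      module Iterψ = Iterate ψ
      module Injφ = PartialInjection φ φ-injective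
      module Injψ = PartialInjection ψ ψ-injective
      module Injχ = PartialInjection χ χ-injective
      module Return = FirstReturn ψ χ position position-injective χ-just χ-nothing

    periodic-φ-iter-InS : ∀ {p x} → iter φ (suc p) x ≡ just x → ∀ t → ∃ λ z → iter φ t x ≡ just z × InS z
    periodic-φ-iter-InS {p} {x} per t
      with w , ew ← Iterφ.iter-prefix (suc t) (suc t * suc p ∸ suc t)
             (trans (cong (λ a → iter φ a x) (ℕₚ.m∸n+n≡m (ℕₚ.m≤m*n (suc t) (suc p)))) (Iterφ.iter-multiple p per (suc t)))
      with z , ez , fz ← Iterφ.iter-suc-last t ew
      = z , ez , φ-defined⇒InS fz

    iter-ψ-inside-S⇒iter-φ : ∀ t {x z} → iter ψ t x ≡ just z →
                             (∀ t′ {z′} → t′ < t → iter ψ t′ x ≡ just z′ → InS z′) → iter φ t x ≡ just z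
    iter-ψ-inside-S⇒iter-φ zero    e _ = e
    iter-ψ-inside-S⇒iter-φ (suc t) e inside
      with w , ew , fw ← Iterψ.iter-suc-last t e
      with z′ , fz′ ← InS⇒φ-defined (inside t (ℕₚ.n<1+n t) ew)
      = trans (cong (_>>= φ) (iter-ψ-inside-S⇒iter-φ t ew (λ t′ t′<t → inside t′ (ℕₚ.m<n⇒m<1+n t′<t))))
              (trans fz′ (trans (sym (φ⊆ψ fz′)) fw))

    leaderφ⇒leaderψ : ∀ {x} → Cφ.Leader x → Cψ.Leader x × InS x
    leaderφ⇒leaderψ {x} ((p , per) , min) = ((p , iter-φ⊆iter-ψ (suc (toℕ p)) per) , minψ) , x∈S
      where
      x∈S = periodic-φ-iter-InS {p = toℕ p} per 0 .proj₂ .proj₂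
      minψ : Cψ.KeyMinimal x
      minψ = Cψ.keyMinimal-intro bound
        where
        bound : ∀ (l : Fin n) {i} → iter ψ (toℕ l) x ≡ just i → key x ≤ key i
        bound l e with z , ez , z∈S ← periodic-φ-iter-InS {p = toℕ p} per (toℕ l)
                  with refl ← just-injective (trans (sym (iter-φ⊆iter-ψ (toℕ l) ez)) e) =
          subst₂ _≤_ (sym (key-InS x∈S)) (sym (key-InS z∈S)) (ℕₚ.+-monoʳ-≤ n (Cφ.keyMinimal-≤ min l ez))

    leaderψ-InS⇒leaderφ : ∀ {x} → Cψ.Leader x → InS x → Cφ.Leader x
    leaderψ-InS⇒leaderφ {x} ((p , per) , min) x∈S = (p , perφ) , Cφ.keyMinimal-intro bound
      where
      inside : ∀ t′ {z′} → t′ < suc (toℕ p) → iter ψ t′ x ≡ just z′ → InS z′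
      inside t′ {z′} t′<p e with InS? z′
      ... | yes z′∈S = z′∈S
      ... | no  z′∉S = ⊥-elim (ℕₚ.<⇒≱ (ℕₚ.<-≤-trans (toℕ<n z′) (ℕₚ.m≤m+n n (toℕ x)))
                         (subst₂ _≤_ (key-InS x∈S) (key-∉S z′∉S)
                           (Cψ.keyMinimal-≤ min (fromℕ< t′<n) (trans (cong (λ a → iter ψ a x) (toℕ-fromℕ< t′<n)) e))))
        where t′<n = ℕₚ.<-≤-trans t′<p (toℕ<n p)
      perφ : iter φ (suc (toℕ p)) x ≡ just x
      perφ = iter-ψ-inside-S⇒iter-φ (suc (toℕ p)) per inside
      bound : ∀ (l : Fin n) {i} → iter φ (toℕ l) x ≡ just i → toℕ x ≤ toℕ i
      bound l e with z , ez , z∈S ← periodic-φ-iter-InS {p = toℕ p} perφ (toℕ l)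
                with refl ← just-injective (trans (sym ez) e) =
        ℕₚ.+-cancelˡ-≤ n (toℕ x) (toℕ z)
          (subst₂ _≤_ (key-InS x∈S) (key-InS z∈S) (Cψ.keyMinimal-≤ min l (iter-φ⊆iter-ψ (toℕ l) e)))

    leaderχ⇒leaderψ : ∀ {s} → Cχ.Leader s → Cψ.Leader (position s)
    leaderχ⇒leaderψ {s} ((p , per) , min) = periodic , Cψ.keyMinimal-intro bound
      where
      periodic : Cψ.Periodic (position s)
      periodic with suc a , _ , r ← Return.iter-return⇒iter (suc (toℕ p)) per = Injψ.period-bounded a r
      bound : ∀ (l : Fin n) {i} → iter ψ (toℕ l) (position s) ≡ just i → key (position s) ≤ key i
      bound l {i} e with toSum (InS? i)
      ... | inj₁ i∈S = subst₂ _≤_ (sym (key-∉S (position-∉S s))) (sym (key-InS i∈S))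
                        (ℕₚ.≤-trans (ℕₚ.<⇒≤ (toℕ<n (position s))) (ℕₚ.m≤m+n n (toℕ i)))
      ... | inj₂ i∉S with s′ , refl ← position-onto i∉S with toℕ l | e
      ...   | zero   | e₀ = ℕₚ.≤-reflexive (cong key (just-injective e₀))
      ...   | suc l′ | e′ with p′ , r ← Return.iter⇒iter-return l′ e′
                          with l″ , r′ ← Cχ.periodic-iter-bounded (p , per) (suc p′) r =
        subst₂ _≤_ (sym (key-∉S (position-∉S s))) (sym (key-∉S (position-∉S s′))) (Cχ.keyMinimal-≤ min l″ r′)

    leaderψ⇒leaderχ : ∀ {s} → Cψ.Leader (position s) → Cχ.Leader s
    leaderψ⇒leaderχ {s} ((p , per) , min) = periodic , Cχ.keyMinimal-intro bound
      where
      periodic : Cχ.Periodic s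
      periodic with p′ , r ← Return.iter⇒iter-return (toℕ p) per = Injχ.period-bounded p′ r
      bound : ∀ (l : Fin (length φ̄)) {s′} → iter χ (toℕ l) s ≡ just s′ → toℕ (position s) ≤ toℕ (position s′)
      bound l e with a , _ , r ← Return.iter-return⇒iter (toℕ l) e
                with l″ , r′ ← Cψ.periodic-iter-bounded (p , per) a r =
        subst₂ _≤_ (key-∉S (position-∉S s)) (key-∉S (position-∉S _)) (Cψ.keyMinimal-≤ min l″ r′)

    cycles-ψ : cycles ψ ≡ cycles φ + cycles χ
    cycles-ψ = begin
      cycles ψ
        ≡⟨ Cψ.cycles≡#leaders ⟩
      length (filter Cψ.leader? (allFin n))
        ≡⟨ length-filter-split Cψ.leader? InS? (allFin n) ⟩
      length (filter (λ x → Cψ.leader? x ×-dec InS? x) (allFin n)) +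
      length (filter (λ x → Cψ.leader? x ×-dec ¬? (InS? x)) (allFin n))
        ≡⟨ cong₂ _+_ leaders-in-S leaders-outside-S ⟨
      length (filter Cφ.leader? (allFin n)) + length (filter Cχ.leader? (allFin (length φ̄)))
        ≡⟨ cong₂ _+_ Cφ.cycles≡#leaders Cχ.cycles≡#leaders ⟨
      cycles φ + cycles χ ∎
      where
      open ≡-Reasoning
      leaders-in-S : length (filter Cφ.leader? (allFin n)) ≡
                     length (filter (λ x → Cψ.leader? x ×-dec InS? x) (allFin n))
      leaders-in-S = length-filter-bijection Cφ.leader? (λ x → Cψ.leader? x ×-dec InS? x) (λ x → x)
        (allFin n) (allFin n) (allFin⁺ n) (allFin⁺ n)
        (λ {x} _ ℓ → ∈-allFin x , leaderφ⇒leaderψ ℓ)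
        (λ {x} _ (ℓ , x∈S) → x , ∈-allFin x , leaderψ-InS⇒leaderφ ℓ x∈S , refl)
        (λ _ _ _ _ e → e)
      leaders-outside-S : length (filter Cχ.leader? (allFin (length φ̄))) ≡
                          length (filter (λ x → Cψ.leader? x ×-dec ¬? (InS? x)) (allFin n))
      leaders-outside-S = length-filter-bijection Cχ.leader? (λ x → Cψ.leader? x ×-dec ¬? (InS? x)) position
        (allFin _) (allFin n) (allFin⁺ _) (allFin⁺ n)
        (λ {s} _ ℓ → ∈-allFin (position s) , leaderχ⇒leaderψ ℓ , position-∉S s)
        (λ {x} _ (ℓ , x∉S) → let s , e = position-onto x∉S in
                             s , ∈-allFin s , leaderψ⇒leaderχ (subst Cψ.Leader (sym e) ℓ) , e)
        (λ _ _ _ _ e → position-injective e)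

open Combinatorics

module RingSums {c ℓ} (R : CommutativeRing c ℓ) where
  open CommutativeRing R
    renaming (refl to ≈-refl; sym to ≈-sym; trans to ≈-trans)
  open import Relation.Binary.Reasoning.Setoid setoid
  open CommutativeMonoidSum +-commutativeMonoid public using (sumMap-++; sumMap-map; sumMap-cong; sumMap-bijection)
  private module Product = CommutativeMonoidSum *-commutativeMonoid

  pow-+ : ∀ x a b → pow R x (a ℕ.+ b) ≈ pow R x a * pow R x b
  pow-+ x zero    b = ≈-sym (*-identityˡ _)
  pow-+ x (suc a) b = ≈-trans (*-congˡ (pow-+ x a b)) (≈-sym (*-assoc _ _ _))

  prodF-cong : ∀ {p} {F G : Fin p → Carrier} → (∀ i → F i ≈ G i) → prodF R F ≈ prodF R G
  prodF-cong {zero}  h = ≈-refl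
  prodF-cong {suc p} h = *-cong (h Fin.zero) (prodF-cong (λ i → h (Fin.suc i)))

  prodF≡product : ∀ {p} (F : Fin p → Carrier) → prodF R F ≡ Product.sumMap F (allFin p)
  prodF≡product {zero}  F = refl
  prodF≡product {suc p} F = cong (F Fin.zero *_) (trans (prodF≡product (λ i → F (Fin.suc i)))
    (trans (sym (Product.sumMap-map F Fin.suc (allFin p)))
             (cong (Product.sumMap F) (Listₚ.map-tabulate (λ i → i) Fin.suc))))

  *-distribˡ-sumL : ∀ {a} {X : Set a} x (w : X → Carrier) xs → x * sumL R (map w xs) ≈ sumL R (map (λ y → x * w y) xs)
  *-distribˡ-sumL x w []       = zeroʳ x
  *-distribˡ-sumL x w (y ∷ xs) = ≈-trans (distribˡ x _ _) (+-congˡ (*-distribˡ-sumL x w xs))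

  sumL-concatMap-pairs : ∀ {a b} {X : Set a} {Y : X → Set b} (xs : List X) (ys : (x : X) → List (Y x))
    (outer : X → Carrier) (inner : (x : X) → Y x → Carrier) →
    sumL R (map (λ x → outer x * sumL R (map (inner x) (ys x))) xs) ≈
    sumL R (map (λ ((x , y) : Σ X Y) → outer x * inner x y) (concatMap (λ x → map (x ,_) (ys x)) xs))
  sumL-concatMap-pairs []       ys outer inner = ≈-refl
  sumL-concatMap-pairs (x ∷ xs) ys outer inner = begin
    outer x * sumL R (map (inner x) (ys x)) + _
      ≈⟨ +-cong (*-distribˡ-sumL (outer x) (inner x) (ys x)) (sumL-concatMap-pairs xs ys outer inner) ⟩
    sumL R (map (λ y → outer x * inner x y) (ys x)) + sumL R (map w (concatMap (λ x → map (x ,_) (ys x)) xs))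
      ≡⟨ cong (_+ sumL R (map w (concatMap (λ x → map (x ,_) (ys x)) xs))) (sumMap-map w (x ,_) (ys x)) ⟨
    sumL R (map w (map (x ,_) (ys x))) + sumL R (map w (concatMap (λ x → map (x ,_) (ys x)) xs))
      ≈⟨ sumMap-++ w (map (x ,_) (ys x)) _ ⟨
    sumL R (map w (map (x ,_) (ys x) ++ concatMap (λ x → map (x ,_) (ys x)) xs)) ∎
    where w = λ ((x , y) : Σ _ _) → outer x * inner x y

  module _ {m n k : ℕ} (m≤n : m ≤ n) (β : Fin k → Fin m) (β-injective : ∀ {l l′} → β l ≡ β l′ → l ≡ l′) where
    open FreeIndices m≤n β β-injective

    private
      row : Fin k ⊎ Fin (length freeRows) → Fin m
      row (inj₁ l) = β l
      row (inj₂ r) = List.lookup freeRows r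

      rowIndices : List (Fin k ⊎ Fin (length freeRows))
      rowIndices = map inj₁ (allFin k) ++ map inj₂ (allFin (length freeRows))

      rowIndices-unique : Unique rowIndices
      rowIndices-unique = ++⁺ (unique-map⁺ inj₁ (λ { _ _ refl → refl }) (allFin⁺ k))
                              (unique-map⁺ inj₂ (λ { _ _ refl → refl }) (allFin⁺ _))
                              λ (p , q) → case (∈-map⁻ inj₁ p , ∈-map⁻ inj₂ q) of λ { ((_ , _ , refl) , (_ , _ , ())) }

      row-injective : ∀ {x y} → row x ≡ row y → x ≡ y
      row-injective {inj₁ l} {inj₁ l′} e = cong inj₁ (β-injective e)
      row-injective {inj₁ l} {inj₂ r}  e = ⊥-elim (lookup-freeRows-∉β r (l , e))
      row-injective {inj₂ r} {inj₁ l}  e = ⊥-elim (lookup-freeRows-∉β r (l , sym e))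
      row-injective {inj₂ r} {inj₂ r′} e = cong inj₂ (lookup-injective freeRows-unique e)

      row-onto : ∀ i → ∃ λ x → x ∈ rowIndices × row x ≡ i
      row-onto i with rowCases i
      ... | inj₁ (l , e) = inj₁ l , ∈-++⁺ˡ (∈-map⁺ inj₁ (∈-allFin l)) , e
      ... | inj₂ (r , e) = inj₂ r , ∈-++⁺ʳ _ (∈-map⁺ inj₂ (∈-allFin r)) , e

    prodF-splitRows : (F : Fin m → Carrier) →
      prodF R F ≈ prodF R (λ l → F (β l)) * prodF R (λ r → F (List.lookup freeRows r))
    prodF-splitRows F = begin
      prodF R F
        ≡⟨ prodF≡product F ⟩
      Product.sumMap F (allFin m)
        ≈⟨ Product.sumMap-bijection F row rowIndices (allFin m) rowIndices-unique (allFin⁺ m)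
             (λ _ → ∈-allFin _) (λ _ → row-onto _) (λ _ _ → row-injective) ⟨
      Product.sumMap (λ x → F (row x)) rowIndices
        ≈⟨ Product.sumMap-++ _ (map inj₁ (allFin k)) _ ⟩
      Product.sumMap (λ x → F (row x)) (map inj₁ (allFin k)) * Product.sumMap (λ x → F (row x)) (map inj₂ (allFin _))
        ≡⟨ cong₂ _*_ (trans (Product.sumMap-map (λ x → F (row x)) inj₁ (allFin k)) (sym (prodF≡product (λ l → F (β l)))))
                       (trans (Product.sumMap-map (λ x → F (row x)) inj₂ (allFin (length freeRows)))
                                (sym (prodF≡product (λ r → F (List.lookup freeRows r))))) ⟩
      prodF R (λ l → F (β l)) * prodF R (λ r → F (List.lookup freeRows r)) ∎

module Expansion {c ℓ} (R : CommutativeRing c ℓ) {m n k : ℕ} (A : Fin m → Fin n → CommutativeRing.Carrier R)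
                 (z : CommutativeRing.Carrier R) (m≤n : m ≤ n) (β : Fin k → Fin m)
                 (β-injective : ∀ {l l′} → β l ≡ β l′ → l ≡ l′) where
  open CommutativeRing R
    renaming (refl to ≈-refl; sym to ≈-sym; trans to ≈-trans)
  open RingSums R
  open FreeIndices m≤n β β-injective
  open Gluing m≤n β β-injective using (glue)
  open import Relation.Binary.Reasoning.Setoid setoid
  open import Algebra.Properties.CommutativeSemigroup *-commutativeSemigroup using (interchange)

  InnerInjection : Vec (Fin n) k → Set
  InnerInjection gv = Vec (Fin (length (φbar m≤n β (lookup gv)))) (length freeRows)

  innerInjections : (gv : Vec (Fin n) k) → List (InnerInjection gv)
  innerInjections gv = injections (length freeRows) (length (φbar m≤n β (lookup gv)))

  pairs : List (Σ (Vec (Fin n) k) InnerInjection)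
  pairs = concatMap (λ gv → map (gv ,_) (innerInjections gv)) (injections k n)

  glueVec : Σ (Vec (Fin n) k) InnerInjection → Vec (Fin n) m
  glueVec (gv , uv) = tabulate (glue (lookup gv) (lookup uv))

  term : Vec (Fin n) m → Carrier
  term v = pow R z (cycles (injMap (lookup v))) * prodF R (λ i → A i (lookup v i))

  outerTerm : Vec (Fin n) k → Carrier
  outerTerm gv = pow R z (cycles (φmap m≤n β (lookup gv))) * prodF R (λ l → A (β l) (lookup gv l))

  innerTerm : (gv : Vec (Fin n) k) → InnerInjection gv → Carrier
  innerTerm gv uv = pow R z (cycles (injMap (lookup uv)))
                  * prodF R (λ i → subMatrix R A freeRows (φbar m≤n β (lookup gv)) i (lookup uv i))

  ∈-pairs⁻ : ∀ {gv uv} → (gv , uv) ∈ pairs → gv ∈ injections k n × uv ∈ innerInjections gv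
  ∈-pairs⁻ p with gv , gv∈ , q ← ∈-concatMap-elim (λ gv → map (gv ,_) (innerInjections gv)) (injections k n) p
             with uv , uv∈ , refl ← ∈-map⁻ (gv ,_) q = gv∈ , uv∈

  pairs-unique : Unique pairs
  pairs-unique = unique-concatMap⁺ _ (injections-unique k n)
    (λ _ → unique-map⁺ _ (λ { _ _ refl → refl }) (injections-unique _ _))
    λ {gv} {gv′} _ _ p p′ → case (∈-map⁻ (gv ,_) p , ∈-map⁻ (gv′ ,_) p′) of λ { ((_ , _ , refl) , (_ , _ , refl)) → refl }

  module _ {gv uv} (p : (gv , uv) ∈ pairs) where
    private
      g-injective = ∈-injections⁻ (∈-pairs⁻ p .proj₁)
      u-injective = ∈-injections⁻ (∈-pairs⁻ p .proj₂)
      open InjectionOnS m≤n β β-injective (lookup gv) g-injective using (φ)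
      open Gluing.Glued m≤n β β-injective (lookup gv) g-injective (lookup uv) u-injective
      open GluedCycles m≤n β β-injective (lookup gv) g-injective (lookup uv) u-injective using (cycles-ψ)

    lookup-glueVec : ∀ i → lookup (glueVec (gv , uv)) i ≡ v i
    lookup-glueVec = Vecₚ.lookup∘tabulate v

    glueVec-injection : glueVec (gv , uv) ∈ injections m n
    glueVec-injection = ∈-injections⁺ _ λ i j e →
      v-injective (trans (sym (lookup-glueVec i)) (trans e (lookup-glueVec j)))

    term-glueVec : term (glueVec (gv , uv)) ≈ outerTerm gv * innerTerm gv uv
    term-glueVec = begin
      pow R z (cycles ψ) * prodF R (λ i → A i (lookup (glueVec (gv , uv)) i))
        ≈⟨ *-cong (≈-trans (reflexive (cong (pow R z) cycles-ψ)) (pow-+ z (cycles φ) (cycles χ))) (prodF-splitRows m≤n β β-injective _) ⟩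
      (pow R z (cycles φ) * pow R z (cycles χ)) *
      (prodF R (λ l → A (β l) (lookup (glueVec (gv , uv)) (β l))) *
       prodF R (λ r → A (List.lookup freeRows r) (lookup (glueVec (gv , uv)) (List.lookup freeRows r))))
        ≈⟨ interchange _ _ _ _ ⟩
      (pow R z (cycles φ) * prodF R (λ l → A (β l) (lookup (glueVec (gv , uv)) (β l)))) *
      (pow R z (cycles χ) * prodF R (λ r → A (List.lookup freeRows r) (lookup (glueVec (gv , uv)) (List.lookup freeRows r))))
        ≈⟨ *-cong (*-congˡ (prodF-cong λ l → reflexive (cong (A (β l)) (trans (lookup-glueVec (β l)) (v-β l)))))
                  (*-congˡ (prodF-cong λ r → reflexive (cong (A _) (trans (lookup-glueVec _) (v-freeRow r))))) ⟩
      outerTerm gv * innerTerm gv uv ∎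

  glueVec-injective : ∀ {gv uv gv′ uv′} (p : (gv , uv) ∈ pairs) (p′ : (gv′ , uv′) ∈ pairs) →
                      glueVec (gv , uv) ≡ glueVec (gv′ , uv′) → (gv , uv) ≡ (gv′ , uv′)
  glueVec-injective {gv} {uv} {gv′} {uv′} p p′ e = pair (vec-ext same-g)
    where
    module V = Gluing.Glued m≤n β β-injective (lookup gv) (∈-injections⁻ (∈-pairs⁻ p .proj₁))
                                                (lookup uv) (∈-injections⁻ (∈-pairs⁻ p .proj₂))
    module V′ = Gluing.Glued m≤n β β-injective (lookup gv′) (∈-injections⁻ (∈-pairs⁻ p′ .proj₁))
                                                 (lookup uv′) (∈-injections⁻ (∈-pairs⁻ p′ .proj₂))
    same : ∀ i → V.v i ≡ V′.v i
    same i = trans (sym (lookup-glueVec p i)) (trans (cong (λ w → lookup w i) e) (lookup-glueVec p′ i))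
    same-g : ∀ l → lookup gv l ≡ lookup gv′ l
    same-g l = trans (sym (V.v-β l)) (trans (same (β l)) (V′.v-β l))
    pair : gv ≡ gv′ → (gv , uv) ≡ (gv′ , uv′)
    pair refl = cong (gv ,_) (vec-ext λ r → lookup-injective (InjectionOnS.φ̄-unique m≤n β β-injective (lookup gv) (∈-injections⁻ (∈-pairs⁻ p .proj₁)))
                    (trans (sym (V.v-freeRow r)) (trans (same _) (V′.v-freeRow r))))

  module Decompose {v : Vec (Fin n) m} (v∈ : v ∈ injections m n) where
    private
      v-injective = ∈-injections⁻ v∈

    gv : Vec (Fin n) k
    gv = tabulate (λ l → lookup v (β l))

    lookup-gv : ∀ l → lookup gv l ≡ lookup v (β l)
    lookup-gv = Vecₚ.lookup∘tabulate _

    g-injective : ∀ {l l′} → lookup gv l ≡ lookup gv l′ → l ≡ l′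
    g-injective {l} {l′} e = β-injective (v-injective (trans (sym (lookup-gv l)) (trans e (lookup-gv l′))))

    open InjectionOnS m≤n β β-injective (lookup gv) g-injective using (φ̄; InImage; ∈-φ̄)

    freeRow-∉image : ∀ r → ¬ InImage (lookup v (List.lookup freeRows r))
    freeRow-∉image r (l , e) = lookup-freeRows-∉β r (l , v-injective (trans (sym (lookup-gv l)) e))

    uv : InnerInjection gv
    uv = tabulate (λ r → Any.index (∈-φ̄ (freeRow-∉image r)))

    lookup-uv : ∀ r → List.lookup φ̄ (lookup uv r) ≡ lookup v (List.lookup freeRows r)
    lookup-uv r = trans (cong (List.lookup φ̄) (Vecₚ.lookup∘tabulate _ r)) (sym (lookup-index (∈-φ̄ (freeRow-∉image r))))

    u-injective : ∀ {r r′} → lookup uv r ≡ lookup uv r′ → r ≡ r′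
    u-injective {r} {r′} e = lookup-injective freeRows-unique
      (v-injective (trans (sym (lookup-uv r)) (trans (cong (List.lookup φ̄) e) (lookup-uv r′))))

    ∈-pairs : (gv , uv) ∈ pairs
    ∈-pairs = ∈-concatMap-intro _ (∈-injections⁺ gv λ _ _ → g-injective)
                                  (∈-map⁺ (gv ,_) (∈-injections⁺ uv λ _ _ → u-injective))

    glueVec-decompose : glueVec (gv , uv) ≡ v
    glueVec-decompose = vec-ext λ i → trans (Vecₚ.lookup∘tabulate _ i) (glue-cases i)
      where
      glue-cases : ∀ i → glue (lookup gv) (lookup uv) i ≡ lookup v i
      glue-cases i with rowCases i
      ... | inj₁ (l , refl) = lookup-gv l
      ... | inj₂ (r , refl) = lookup-uv r

  per≈expansion : per R z A ≈ expansion R m≤n z A β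
  per≈expansion = begin
    sumL R (map term (injections m n))
      ≈⟨ sumMap-bijection term glueVec pairs (injections m n) pairs-unique (injections-unique m n)
           glueVec-injection (λ v∈ → _ , Decompose.∈-pairs v∈ , Decompose.glueVec-decompose v∈) glueVec-injective ⟨
    sumL R (map (λ p → term (glueVec p)) pairs)
      ≈⟨ sumMap-cong pairs term-glueVec ⟩
    sumL R (map (λ (gv , uv) → outerTerm gv * innerTerm gv uv) pairs)
      ≈⟨ sumL-concatMap-pairs (injections k n) innerInjections outerTerm innerTerm ⟨
    expansion R m≤n z A β ∎

strictlyIncreasing⇒injective : ∀ {k m} {β : Fin k → Fin m} → (∀ i j → i Fin.< j → β i Fin.< β j) →
                               ∀ {l l′} → β l ≡ β l′ → l ≡ l′
strictlyIncreasing⇒injective increasing {l} {l′} e with Data.Fin.Properties.<-cmp l l′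
... | tri< l<l′ _ _ = ⊥-elim (Data.Fin.Properties.<-irrefl e (increasing l l′ l<l′))
... | tri≈ _ l≡l′ _ = l≡l′
... | tri> _ _ l′<l = ⊥-elim (Data.Fin.Properties.<-irrefl (sym e) (increasing l′ l l′<l))

theorem4 : ∀ {c ℓ : Level} (R : CommutativeRing c ℓ) (m n k : ℕ)
    (A : Fin m → Fin n → CommutativeRing.Carrier R) (z : CommutativeRing.Carrier R)
    (m≤n : m ≤ n) → 1 ≤ k → k < m →
    (β : Fin k → Fin m) → (∀ i j → i Fin.< j → β i Fin.< β j) →
    CommutativeRing._≈_ R (per R z A) (expansion R m≤n z A β)
theorem4 R m n k A z m≤n _ _ β increasing =
  Expansion.per≈expansion R A z m≤n β (strictlyIncreasing⇒injective increasing)
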